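{- Let $q>2$ be a prime power, $s\geq 3$ an integer, and let $\Omega$ be a non-empty family of hyperplanes of $\mathrm{PG}(s,q^2)$ such that every point lies in exactly $\frac{q^s(q^{s-1}-(-1)^{s-1})}{q+1}$ or exactly $\frac{q^{s-1}(q^s-(-1)^s)}{q+1}$ hyperplanes of $\Omega$. Call a point black if it lies in exactly $\frac{q^s(q^{s-1}-(-1)^{s-1})}{q+1}$ hyperplanes of $\Omega$. Then for every hyperplane $\Phi\in\Omega$, the number $b_\Phi$ of black points in $\Phi$ is $$b_\Phi=\frac{(-1)^s}{q^{s-1}}\left[(|\Omega|-1)\frac{q^{2s-2}-1}{q^2-1}-\frac{q^{2s}-1}{q^2-1}\left(\frac{q^{s-1}(q^s-(-1)^s)}{q+1}-1\right)\right].$$ -}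

module Defs where

open import Level using (Level; _⊔_) renaming (suc to lsuc)
open import Algebra.Bundles using (CommutativeRing)
open import Data.Nat as ℕ using (ℕ; zero; suc; _≥_; _^_)
open import Data.Nat.Primality using (Prime)
open import Data.Integer as ℤ using (ℤ)
open import Data.Rational as ℚ using (ℚ)
open import Data.List using (List; []; _∷_; map; concatMap; filter; length)
open import Data.List.Relation.Unary.Any using (Any)
open import Data.List.Relation.Unary.AllPairs using (AllPairs)
open import Data.Vec using (Vec; []; _∷_)
open import Data.Product using (Σ; ∃; _×_; _,_)
open import Data.Sum using (_⊎_)
open import Data.Empty using (⊥)
open import Relation.Nullary using (¬_; Dec; yes; no)
open import Relation.Nullary.Decidable using (_×-dec_; _⊎-dec_)
open import Relation.Binary using (Decidable)
open import Relation.Binary.PropositionalEquality using (_≡_)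
open import Data.List.Relation.Unary.All using (All)
open import Data.Unit using (⊤)

IsPrimePower : ℕ → Set
IsPrimePower q = ∃ λ p → ∃ λ k → Prime p × k ≥ 1 × q ≡ p ^ k

record FiniteField (c ℓ : Level) : Set (lsuc (c ⊔ ℓ)) where
  field
    commRing : CommutativeRing c ℓ
  open CommutativeRing commRing public
  field
    0≉1      : ¬ (0# ≈ 1#)
    inverse  : ∀ x → ¬ (x ≈ 0#) → ∃ λ y → (x * y) ≈ 1#
    _≟_      : Decidable _≈_
    elements : List Carrier
    complete : ∀ x → Any (x ≈_) elements
    distinct : AllPairs (λ x y → ¬ (x ≈ y)) elements

  order : ℕ
  order = length elements

module Projective {c ℓ : Level} (F : FiniteField c ℓ) where
  open FiniteField F

  allVecs : (n : ℕ) → List (Vec Carrier n)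
  allVecs zero    = [] ∷ []
  allVecs (suc n) = concatMap (λ x → map (x ∷_) (allVecs n)) elements

  -- a vector is normalized if it is nonzero and its first nonzero
  -- coordinate equals 1; these are canonical representatives of the
  -- points (and, dually, hyperplanes) of the projective space
  Normalized : ∀ {n} → Vec Carrier n → Set ℓ
  Normalized []      = Level.Lift _ ⊥
  Normalized (x ∷ v) = (x ≈ 1#) ⊎ ((x ≈ 0#) × Normalized v)

  normalized? : ∀ {n} (v : Vec Carrier n) → Dec (Normalized v)
  normalized? []      = no (λ ())
  normalized? (x ∷ v) = (x ≟ 1#) ⊎-dec ((x ≟ 0#) ×-dec normalized? v)

  points : (s : ℕ) → List (Vec Carrier (suc s))
  points s = filter normalized? (allVecs (suc s))

  _·_ : ∀ {n} → Vec Carrier n → Vec Carrier n → Carrier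
  []      · []      = 0#
  (a ∷ u) · (x ∷ v) = (a * x) + (u · v)

  Incident : ∀ {n} → Vec Carrier n → Vec Carrier n → Set ℓ
  Incident H P = (H · P) ≈ 0#

  incident? : ∀ {n} (H P : Vec Carrier n) → Dec (Incident H P)
  incident? H P = (H · P) ≟ 0#

  _≋_ : ∀ {n} → Vec Carrier n → Vec Carrier n → Set ℓ
  []      ≋ []      = Level.Lift _ ⊤
  (x ∷ u) ≋ (y ∷ v) = (x ≈ y) × (u ≋ v)

  record HyperplaneFamily (s : ℕ) : Set (c ⊔ ℓ) where
    field
      members    : List (Vec Carrier (suc s))
      normal     : All Normalized members
      noRepeats  : AllPairs (λ H K → ¬ (H ≋ K)) members
    size : ℕ
    size = length members
    degree : Vec Carrier (suc s) → ℕ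
    degree P = length (filter (λ H → incident? H P) members)

negOnePow : ℕ → ℤ
negOnePow zero    = ℤ.+ 1
negOnePow (suc n) = ℤ.- negOnePow n

kBlack : ℕ → ℕ → ℚ
kBlack q s = (ℤ.+ (q ^ s) ℤ.* (ℤ.+ (q ^ (s ℕ.∸ 1)) ℤ.- negOnePow (s ℕ.∸ 1))) ℚ./ suc q

kWhite : ℕ → ℕ → ℚ
kWhite q s = (ℤ.+ (q ^ (s ℕ.∸ 1)) ℤ.* (ℤ.+ (q ^ s) ℤ.- negOnePow s)) ℚ./ suc q

-- division of a rational by a natural number (only ever used with a
-- nonzero divisor; the value at 0 is an irrelevant junk value)
_/ℕ_ : ℚ → ℕ → ℚ
x /ℕ zero  = ℚ.0ℚ
x /ℕ suc m = x ℚ.* (ℤ.+ 1 ℚ./ suc m)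

ℕtoℚ : ℕ → ℚ
ℕtoℚ n = ℤ.+ n ℚ./ 1

blackCount : ℕ → ℕ → ℕ → ℚ
blackCount q s N =
  ((negOnePow s ℚ./ 1) ℚ.* (
      ((ℕtoℚ N ℚ.- ℚ.1ℚ) ℚ.* (ℕtoℚ (q ^ (2 ℕ.* s ℕ.∸ 2) ℕ.∸ 1) /ℕ (q ^ 2 ℕ.∸ 1)))
    ℚ.- ((ℕtoℚ (q ^ (2 ℕ.* s) ℕ.∸ 1) /ℕ (q ^ 2 ℕ.∸ 1)) ℚ.* (kWhite q s ℚ.- ℚ.1ℚ))))
  /ℕ (q ^ (s ℕ.∸ 1))

module ProjectiveCounts {c ℓ : Level} (F : FiniteField c ℓ) (q s : ℕ) where
  open FiniteField F
  open Projective F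

  Black : HyperplaneFamily s → Vec Carrier (suc s) → Set
  Black Ω P = ℕtoℚ (HyperplaneFamily.degree Ω P) ≡ kBlack q s

  black? : (Ω : HyperplaneFamily s) (P : Vec Carrier (suc s)) → Dec (Black Ω P)
  black? Ω P = ℕtoℚ (HyperplaneFamily.degree Ω P) ℚ.≟ kBlack q s

  blackPointsIn : HyperplaneFamily s → Vec Carrier (suc s) → ℕ
  blackPointsIn Ω Φ = length (filter (λ P → black? Ω P ×-dec incident? Φ P) (points s))

{-# OPTIONS --safe #-}
-- Double count the incidences between the points of Φ and the hyperplanes of Ω. Write Q = q² and
-- θ Q n = 1 + Q + ⋯ + Q ^ (n - 1) for the number of points of PG(n - 1, Q). The hyperplane Φ has
-- θ Q s points and meets each of the other |Ω| - 1 hyperplanes in θ Q (s - 1) points (distinct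
-- normalized vectors are linearly independent), so Σ_{P ∈ Φ} deg P = θ Q s + (|Ω| - 1) θ Q (s - 1).
-- Splitting this sum over the b black and w white points of Φ gives b k₁ + w k₂, where b + w = θ Q s
-- and k₁ - k₂ = (-1) ^ s q ^ (s - 1); solving for b gives the formula.
-- The point counts come from splitting PG(n, F) into the affine points 1 ∷ w and the hyperplane
-- 0 ∷ w at infinity: one nonzero (two independent) linear equations on F ^ n have Q ^ (n - 1)
-- (Q ^ (n - 2)) solutions.
module Submission where

open import Defs
open import Level using (Level; lift; _⊔_)
open import Data.Nat as ℕ using (ℕ; zero; suc; _^_; _∸_; _>_; _≥_; s≤s)
import Data.Nat.Properties as ℕₚ
open import Data.Nat.Tactic.RingSolver using (solve-∀)
open import Data.Product using (∃; _×_; _,_; proj₁; proj₂; swap)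
open import Data.Sum using (_⊎_; inj₁; inj₂; [_,_]′)
open import Data.Empty using (⊥-elim)
open import Data.Unit using (tt)
open import Data.List using (List; []; _∷_; _++_; map; concatMap; filter; length)
open import Data.List.Relation.Unary.All as All using (All; []; _∷_)
open import Data.List.Relation.Unary.All.Properties using (All¬⇒¬Any)
open import Data.List.Relation.Unary.Any as Any using (Any; here; there)
open import Data.List.Relation.Unary.AllPairs using (AllPairs; []; _∷_)
open import Data.List.Membership.Propositional using (_∈_)
open import Data.Vec using (Vec; []; _∷_; zipWith)
open import Data.Vec.Relation.Unary.All as Vecᴬ using ([]; _∷_)
open import Data.Vec.Relation.Binary.Pointwise.Inductive as Pointwise
  using (Pointwise; []; _∷_; Pointwiseˡ⇒All; All⇒Pointwiseˡ)
open import Function using (_∘_)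
open import Relation.Binary using (_Preserves_⟶_)
open import Relation.Nullary using (¬_; Dec; yes; no)
open import Relation.Nullary.Decidable using (_×-dec_; _⊎-dec_; ¬?)
open import Relation.Binary.PropositionalEquality as ≡ using (_≡_; refl; cong; cong₂; module ≡-Reasoning)

private
  variable
    ℓ₁ ℓ₂ ℓ₃ ℓ₄ : Level
    A : Set ℓ₁
    B : Set ℓ₂
    P : Set ℓ₃
    R : Set ℓ₄

module _ where
  open import Data.Nat using (_+_; _*_)

  𝟙 : Dec P → ℕ
  𝟙 (yes _) = 1
  𝟙 (no _)  = 0

  𝟙-cong : (P → R) → (R → P) → (d : Dec P) (e : Dec R) → 𝟙 d ≡ 𝟙 e
  𝟙-cong f g (yes p) (yes r) = refl
  𝟙-cong f g (yes p) (no ¬r) = ⊥-elim (¬r (f p))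
  𝟙-cong f g (no ¬p) (yes r) = ⊥-elim (¬p (g r))
  𝟙-cong f g (no ¬p) (no ¬r) = refl

  𝟙-yes : P → (d : Dec P) → 𝟙 d ≡ 1
  𝟙-yes p (yes _) = refl
  𝟙-yes p (no ¬p) = ⊥-elim (¬p p)

  𝟙-no : ¬ P → (d : Dec P) → 𝟙 d ≡ 0
  𝟙-no ¬p (yes p) = ⊥-elim (¬p p)
  𝟙-no ¬p (no _)  = refl

  𝟙-× : (d : Dec P) (e : Dec R) → 𝟙 (d ×-dec e) ≡ 𝟙 d * 𝟙 e
  𝟙-× (yes _) (yes _) = refl
  𝟙-× (yes _) (no _)  = refl
  𝟙-× (no _)  _       = refl

  𝟙-⊎-disjoint : ¬ (P × R) → (d : Dec P) (e : Dec R) → 𝟙 (d ⊎-dec e) ≡ 𝟙 d + 𝟙 e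
  𝟙-⊎-disjoint ¬p×r (yes p) (yes r) = ⊥-elim (¬p×r (p , r))
  𝟙-⊎-disjoint ¬p×r (yes _) (no _)  = refl
  𝟙-⊎-disjoint ¬p×r (no _)  (yes _) = refl
  𝟙-⊎-disjoint ¬p×r (no _)  (no _)  = refl

  𝟙*𝟙≡0 : ¬ (P × R) → (d : Dec P) (e : Dec R) → 𝟙 d * 𝟙 e ≡ 0
  𝟙*𝟙≡0 ¬p×r d e = ≡.trans (≡.sym (𝟙-× d e)) (𝟙-no ¬p×r (d ×-dec e))

  𝟙-guard : ∀ {x y} (d : Dec P) → (P → x ≡ y) → 𝟙 d * x ≡ 𝟙 d * y
  𝟙-guard (yes p) x≡y = cong (1 *_) (x≡y p)
  𝟙-guard (no _)  _   = refl

  𝟙-×-partition : (d : Dec P) (e : Dec R) → 𝟙 (d ×-dec e) + 𝟙 (¬? d ×-dec e) ≡ 𝟙 e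
  𝟙-×-partition (yes _) (yes _) = refl
  𝟙-×-partition (yes _) (no _)  = refl
  𝟙-×-partition (no _)  (yes _) = refl
  𝟙-×-partition (no _)  (no _)  = refl

  𝟙-×-two-valued : ∀ {x} k₁ k₂ (d : Dec P) (e : Dec R) →
                   (R → P → x ≡ k₁) → (R → ¬ P → x ≡ k₂) →
                   𝟙 e * x ≡ 𝟙 (d ×-dec e) * k₁ + 𝟙 (¬? d ×-dec e) * k₂
  𝟙-×-two-valued k₁ k₂ (yes p)  (yes r) x≡k₁ _ =
    cong (1 *_) (≡.trans (x≡k₁ r p) (≡.sym (ℕₚ.+-identityʳ k₁)))
  𝟙-×-two-valued k₁ k₂ (no ¬p) (yes r) _ x≡k₂ = cong (1 *_) (x≡k₂ r ¬p)
  𝟙-×-two-valued k₁ k₂ (yes _)  (no _)  _ _    = refl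
  𝟙-×-two-valued k₁ k₂ (no _)  (no _)  _ _    = refl

  𝟙-idem : (d : Dec P) → 𝟙 d * 𝟙 d ≡ 𝟙 d
  𝟙-idem (yes _) = refl
  𝟙-idem (no _)  = refl

  θ : ℕ → ℕ → ℕ
  θ Q zero    = 0
  θ Q (suc n) = Q ^ n + θ Q n

  ∑ : List A → (A → ℕ) → ℕ
  ∑ []       f = 0
  ∑ (x ∷ xs) f = f x + ∑ xs f

  syntax ∑ xs (λ x → e) = ∑[ x ← xs ] e

  ∑-cong : ∀ (xs : List A) {f g : A → ℕ} → (∀ x → f x ≡ g x) → ∑ xs f ≡ ∑ xs g
  ∑-cong []       f≗g = refl
  ∑-cong (x ∷ xs) f≗g = cong₂ _+_ (f≗g x) (∑-cong xs f≗g)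

  ∑-+ : ∀ (xs : List A) (f g : A → ℕ) → ∑[ x ← xs ] (f x + g x) ≡ ∑ xs f + ∑ xs g
  ∑-+ []       f g = refl
  ∑-+ (x ∷ xs) f g = ≡.trans (cong (f x + g x +_) (∑-+ xs f g))
                           (interchange (f x) (g x) (∑ xs f) (∑ xs g))
    where
    interchange : ∀ m n u v → (m + n) + (u + v) ≡ (m + u) + (n + v)
    interchange = solve-∀

  ∑-*ˡ : ∀ (xs : List A) k (f : A → ℕ) → ∑[ x ← xs ] (k * f x) ≡ k * ∑ xs f
  ∑-*ˡ []       k f = ≡.sym (ℕₚ.*-zeroʳ k)
  ∑-*ˡ (x ∷ xs) k f =
    ≡.trans (cong (k * f x +_) (∑-*ˡ xs k f)) (≡.sym (ℕₚ.*-distribˡ-+ k (f x) (∑ xs f)))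

  ∑-constOn : ∀ (xs : List A) {f : A → ℕ} k → All (λ x → f x ≡ k) xs → ∑ xs f ≡ length xs * k
  ∑-constOn []       k []         = refl
  ∑-constOn (x ∷ xs) k (fx ∷ fxs) = cong₂ _+_ fx (∑-constOn xs k fxs)

  ∑-const : ∀ (xs : List A) k → ∑[ x ← xs ] k ≡ length xs * k
  ∑-const []       k = refl
  ∑-const (x ∷ xs) k = cong (k +_) (∑-const xs k)

  ∑-++ : ∀ (xs ys : List A) (f : A → ℕ) → ∑ (xs ++ ys) f ≡ ∑ xs f + ∑ ys f
  ∑-++ []       ys f = refl
  ∑-++ (x ∷ xs) ys f = ≡.trans (cong (f x +_) (∑-++ xs ys f)) (≡.sym (ℕₚ.+-assoc (f x) _ _))

  ∑-map : ∀ (g : A → B) (xs : List A) (f : B → ℕ) → ∑ (map g xs) f ≡ ∑[ x ← xs ] f (g x)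
  ∑-map g []       f = refl
  ∑-map g (x ∷ xs) f = cong (f (g x) +_) (∑-map g xs f)

  ∑-concatMap : ∀ (g : A → List B) (xs : List A) (f : B → ℕ) →
                ∑ (concatMap g xs) f ≡ ∑[ x ← xs ] ∑ (g x) f
  ∑-concatMap g []       f = refl
  ∑-concatMap g (x ∷ xs) f =
    ≡.trans (∑-++ (g x) (concatMap g xs) f) (cong (∑ (g x) f +_) (∑-concatMap g xs f))

  module _ {Q : A → Set ℓ₃} (Q? : ∀ x → Dec (Q x)) where

    length-filter≡∑𝟙 : ∀ xs → length (filter Q? xs) ≡ ∑[ x ← xs ] 𝟙 (Q? x)
    length-filter≡∑𝟙 []       = refl
    length-filter≡∑𝟙 (x ∷ xs) with Q? x
    ... | yes _ = cong suc (length-filter≡∑𝟙 xs)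
    ... | no _  = length-filter≡∑𝟙 xs

    ∑-filter : ∀ xs (f : A → ℕ) → ∑ (filter Q? xs) f ≡ ∑[ x ← xs ] (𝟙 (Q? x) * f x)
    ∑-filter []       f = refl
    ∑-filter (x ∷ xs) f with Q? x
    ... | yes _ = cong₂ _+_ (≡.sym (ℕₚ.+-identityʳ (f x))) (∑-filter xs f)
    ... | no _  = ∑-filter xs f

module FieldLemmas {c ℓ} (F : FiniteField c ℓ) where
  open FiniteField F hiding (refl)
  open import Algebra.Properties.Ring ring
    using (x≈z//y; //-rightDividesˡ; -‿involutive; -0#≈0#; -‿distribˡ-*)
  open import Relation.Binary.Reasoning.Setoid setoid

  1≉0 : 1# ≉ 0#
  1≉0 1≈0 = 0≉1 (sym 1≈0)

  +-pres-≈0 : ∀ {x y} → x ≈ 0# → y ≈ 0# → x + y ≈ 0#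
  +-pres-≈0 x≈0 y≈0 = trans (+-cong x≈0 y≈0) (+-identityˡ 0#)

  *-presˡ-≈0 : ∀ {x} y → x ≈ 0# → x * y ≈ 0#
  *-presˡ-≈0 y x≈0 = trans (*-congʳ x≈0) (zeroˡ y)

  *-presʳ-≈0 : ∀ {x} y → x ≈ 0# → y * x ≈ 0#
  *-presʳ-≈0 y x≈0 = trans (*-congˡ x≈0) (zeroʳ y)

  -x≈0⇒x≈0 : ∀ {x} → - x ≈ 0# → x ≈ 0#
  -x≈0⇒x≈0 {x} -x≈0 = trans (sym (-‿involutive x)) (trans (-‿cong -x≈0) -0#≈0#)

  inv : ∀ h → h ≉ 0# → Carrier
  inv h h≉0 = proj₁ (inverse h h≉0)

  inv-inverseʳ : ∀ {h} (h≉0 : h ≉ 0#) → h * inv h h≉0 ≈ 1#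
  inv-inverseʳ {h} h≉0 = proj₂ (inverse h h≉0)

  inv-inverseˡ : ∀ {h} (h≉0 : h ≉ 0#) → inv h h≉0 * h ≈ 1#
  inv-inverseˡ {h} h≉0 = trans (*-comm _ h) (inv-inverseʳ h≉0)

  inv-cancelˡ : ∀ {h} (h≉0 : h ≉ 0#) x → inv h h≉0 * (h * x) ≈ x
  inv-cancelˡ {h} h≉0 x = begin
    inv h h≉0 * (h * x)  ≈⟨ *-assoc _ h x ⟨
    inv h h≉0 * h * x    ≈⟨ *-congʳ (inv-inverseˡ h≉0) ⟩
    1# * x               ≈⟨ *-identityˡ x ⟩
    x                    ∎

  inv-cancelʳ : ∀ {h} (h≉0 : h ≉ 0#) x → h * (inv h h≉0 * x) ≈ x
  inv-cancelʳ {h} h≉0 x = begin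
    h * (inv h h≉0 * x)  ≈⟨ *-assoc h _ x ⟨
    h * inv h h≉0 * x    ≈⟨ *-congʳ (inv-inverseʳ h≉0) ⟩
    1# * x               ≈⟨ *-identityˡ x ⟩
    x                    ∎

  *-cancelˡ : ∀ {h x y} → h ≉ 0# → h * x ≈ h * y → x ≈ y
  *-cancelˡ {h} {x} {y} h≉0 hx≈hy = begin
    x                    ≈⟨ inv-cancelˡ h≉0 x ⟨
    inv h h≉0 * (h * x)  ≈⟨ *-congˡ hx≈hy ⟩
    inv h h≉0 * (h * y)  ≈⟨ inv-cancelˡ h≉0 y ⟩
    y                    ∎

  h*x≈0⇒x≈0 : ∀ {h x} → h ≉ 0# → h * x ≈ 0# → x ≈ 0#
  h*x≈0⇒x≈0 {h} h≉0 hx≈0 = *-cancelˡ h≉0 (trans hx≈0 (sym (zeroʳ h)))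

  y*x+-x*y≈0 : ∀ x y → y * x + (- x) * y ≈ 0#
  y*x+-x*y≈0 x y = begin
    y * x + (- x) * y  ≈⟨ +-cong (*-comm y x) (sym (-‿distribˡ-* x y)) ⟩
    x * y + - (x * y)  ≈⟨ -‿inverseʳ _ ⟩
    0#                 ∎

  root : ∀ h → h ≉ 0# → Carrier → Carrier → Carrier
  root h h≉0 w c = inv h h≉0 * (c - w)

  root-unique : ∀ {h} (h≉0 : h ≉ 0#) {x w c} → h * x + w ≈ c → x ≈ root h h≉0 w c
  root-unique {h} h≉0 {x} {w} {c} hx+w≈c = begin
    x                    ≈⟨ inv-cancelˡ h≉0 x ⟨
    inv h h≉0 * (h * x)  ≈⟨ *-congˡ (x≈z//y (h * x) w c hx+w≈c) ⟩
    inv h h≉0 * (c - w)  ∎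

  root-solves : ∀ {h} (h≉0 : h ≉ 0#) {x w c} → x ≈ root h h≉0 w c → h * x + w ≈ c
  root-solves {h} h≉0 {x} {w} {c} x≈root = begin
    h * x + w                      ≈⟨ +-congʳ (*-congˡ x≈root) ⟩
    h * (inv h h≉0 * (c - w)) + w  ≈⟨ +-congʳ (inv-cancelʳ h≉0 (c - w)) ⟩
    (c - w) + w                    ≈⟨ //-rightDividesˡ w c ⟩
    c                              ∎

module FieldSums {c ℓ} (F : FiniteField c ℓ) where
  open FiniteField F hiding (refl)
  open Projective F using (allVecs)
  open FieldLemmas F

  ∑V : ∀ n → (Vec Carrier n → ℕ) → ℕ
  ∑V zero    f = f []
  ∑V (suc n) f = ∑[ x ← elements ] ∑V n (λ v → f (x ∷ v))

  ∑V-cong : ∀ n {f g : Vec Carrier n → ℕ} → (∀ v → f v ≡ g v) → ∑V n f ≡ ∑V n g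
  ∑V-cong zero    f≗g = f≗g []
  ∑V-cong (suc n) f≗g = ∑-cong elements (λ x → ∑V-cong n (λ v → f≗g (x ∷ v)))

  ∑V-+ : ∀ n (f g : Vec Carrier n → ℕ) → ∑V n (λ v → f v ℕ.+ g v) ≡ ∑V n f ℕ.+ ∑V n g
  ∑V-+ zero    f g = refl
  ∑V-+ (suc n) f g = ≡.trans (∑-cong elements (λ x → ∑V-+ n _ _)) (∑-+ elements _ _)

  ∑V-*ˡ : ∀ n k (f : Vec Carrier n → ℕ) → ∑V n (λ v → k ℕ.* f v) ≡ k ℕ.* ∑V n f
  ∑V-*ˡ zero    k f = refl
  ∑V-*ˡ (suc n) k f = ≡.trans (∑-cong elements (λ x → ∑V-*ˡ n k _)) (∑-*ˡ elements k _)

  ∑V-*ʳ : ∀ n k (f : Vec Carrier n → ℕ) → ∑V n (λ v → f v ℕ.* k) ≡ ∑V n f ℕ.* k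
  ∑V-*ʳ n k f = ≡.trans (∑V-cong n (λ v → ℕₚ.*-comm (f v) k))
                        (≡.trans (∑V-*ˡ n k f) (ℕₚ.*-comm k _))

  ∑V-const : ∀ n k → ∑V n (λ _ → k) ≡ order ^ n ℕ.* k
  ∑V-const zero    k = ≡.sym (ℕₚ.+-identityʳ k)
  ∑V-const (suc n) k = ≡.trans (∑-cong elements (λ x → ∑V-const n k))
    (≡.trans (∑-const elements _) (≡.sym (ℕₚ.*-assoc order (order ^ n) k)))

  ∑V-zero : ∀ n {f : Vec Carrier n → ℕ} → (∀ v → f v ≡ 0) → ∑V n f ≡ 0
  ∑V-zero n f≗0 = ≡.trans (∑V-cong n f≗0) (≡.trans (∑V-const n 0) (ℕₚ.*-zeroʳ (order ^ n)))

  ∑-∑V-comm : ∀ {a} {A : Set a} (xs : List A) n (f : A → Vec Carrier n → ℕ) →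
              ∑[ x ← xs ] ∑V n (f x) ≡ ∑V n (λ v → ∑[ x ← xs ] f x v)
  ∑-∑V-comm []       n f = ≡.sym (∑V-zero n (λ v → refl))
  ∑-∑V-comm (x ∷ xs) n f =
    ≡.trans (cong (∑V n (f x) ℕ.+_) (∑-∑V-comm xs n f)) (≡.sym (∑V-+ n (f x) _))

  ∑-allVecs : ∀ n (f : Vec Carrier n → ℕ) → ∑ (allVecs n) f ≡ ∑V n f
  ∑-allVecs zero    f = ℕₚ.+-identityʳ (f [])
  ∑-allVecs (suc n) f = ≡.trans (∑-concatMap _ elements f)
    (∑-cong elements (λ x → ≡.trans (∑-map (x ∷_) (allVecs n) f) (∑-allVecs n _)))

  private
    ∑-𝟙≟-absent : ∀ {x₀} (G : Carrier → ℕ) xs → All (λ x → ¬ x ≈ x₀) xs →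
                  ∑[ x ← xs ] (𝟙 (x ≟ x₀) ℕ.* G x) ≡ 0
    ∑-𝟙≟-absent G []       []            = refl
    ∑-𝟙≟-absent G (x ∷ xs) (x≉x₀ ∷ xs≉x₀) =
      cong₂ ℕ._+_ (cong (ℕ._* G x) (𝟙-no x≉x₀ (x ≟ _))) (∑-𝟙≟-absent G xs xs≉x₀)

    ∑-delta-list : ∀ {x₀} (G : Carrier → ℕ) → G Preserves _≈_ ⟶ _≡_ →
                   ∀ xs → AllPairs (λ x y → ¬ x ≈ y) xs → Any (x₀ ≈_) xs →
                   ∑[ x ← xs ] (𝟙 (x ≟ x₀) ℕ.* G x) ≡ G x₀
    ∑-delta-list G G-resp (x ∷ xs) (x≉xs ∷ _) (here x₀≈x) = ≡.trans
      (cong₂ ℕ._+_ (≡.trans (cong (ℕ._* G x) (𝟙-yes (sym x₀≈x) (x ≟ _)))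
                            (≡.trans (ℕₚ.+-identityʳ (G x)) (G-resp (sym x₀≈x))))
                   (∑-𝟙≟-absent G xs (All.map (λ x≉y y≈x₀ → x≉y (sym (trans y≈x₀ x₀≈x)))
                                              x≉xs)))
      (ℕₚ.+-identityʳ _)
    ∑-delta-list {x₀} G G-resp (x ∷ xs) (x≉xs ∷ xs-distinct) (there x₀∈xs) =
      cong₂ ℕ._+_ (cong (ℕ._* G x) (𝟙-no x≉x₀ (x ≟ x₀)))
                  (∑-delta-list G G-resp xs xs-distinct x₀∈xs)
      where
      x≉x₀ : ¬ x ≈ x₀
      x≉x₀ x≈x₀ =
        All¬⇒¬Any (All.map (λ x≉y x₀≈y → x≉y (trans x≈x₀ x₀≈y)) x≉xs) x₀∈xs

  ∑-delta : ∀ x₀ (G : Carrier → ℕ) → G Preserves _≈_ ⟶ _≡_ →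
            ∑[ x ← elements ] (𝟙 (x ≟ x₀) ℕ.* G x) ≡ G x₀
  ∑-delta x₀ G G-resp = ∑-delta-list G G-resp elements distinct (complete x₀)

  ∑-root : ∀ {h} (h≉0 : h ≉ 0#) w c (G : Carrier → ℕ) → G Preserves _≈_ ⟶ _≡_ →
           ∑[ x ← elements ] (𝟙 ((h * x + w) ≟ c) ℕ.* G x) ≡ G (root h h≉0 w c)
  ∑-root h≉0 w c G G-resp = ≡.trans
    (∑-cong elements (λ x → cong (ℕ._* G x)
      (𝟙-cong (root-unique h≉0) (root-solves h≉0) (_ ≟ c) (x ≟ _))))
    (∑-delta _ G G-resp)

  ∑-𝟙-root : ∀ {h} (h≉0 : h ≉ 0#) w c → ∑[ x ← elements ] 𝟙 ((h * x + w) ≟ c) ≡ 1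
  ∑-𝟙-root h≉0 w c = ≡.trans (∑-cong elements (λ x → ≡.sym (ℕₚ.*-identityʳ _)))
                             (∑-root h≉0 w c (λ _ → 1) (λ _ → refl))

module LinearAlgebra {c ℓ} (F : FiniteField c ℓ) where
  open FiniteField F renaming (refl to ≈-refl)
  open Projective F
  open FieldLemmas F
  open import Algebra.Properties.Ring ring
    using (-‿distribˡ-*; -‿distribʳ-*; +-inverseʳ-unique; x∙y⁻¹≈ε⇒x≈y)
  open import Algebra.Properties.CommutativeSemigroup +-commutativeSemigroup using (interchange)
  open import Relation.Binary.Reasoning.Setoid setoid

  private
    variable
      n : ℕ
      a b : Vec Carrier n

  IsZero : Vec Carrier n → Set (c ⊔ ℓ)
  IsZero = Vecᴬ.All (_≈ 0#)

  isZero? : (v : Vec Carrier n) → Dec (IsZero v)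
  isZero? = Vecᴬ.all? (_≟ 0#)

  LinearRelation : Carrier → Carrier → Vec Carrier n → Vec Carrier n → Set (c ⊔ ℓ)
  LinearRelation l m = Pointwise (λ x y → l * x + m * y ≈ 0#)

  Independent : Vec Carrier n → Vec Carrier n → Set (c ⊔ ℓ)
  Independent a b = ∀ {l m} → LinearRelation l m a b → l ≈ 0# × m ≈ 0#

  Proportional : Carrier → Vec Carrier n → Vec Carrier n → Set (c ⊔ ℓ)
  Proportional t = Pointwise (λ x y → y ≈ t * x)

  lincomb : Carrier → Carrier → Vec Carrier n → Vec Carrier n → Vec Carrier n
  lincomb l m = zipWith (λ x y → l * x + m * y)

  ·-IsZeroˡ : ∀ (v : Vec Carrier n) → IsZero a → a · v ≈ 0#
  ·-IsZeroˡ []      []            = ≈-refl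
  ·-IsZeroˡ (y ∷ v) (x≈0 ∷ a≈0) = +-pres-≈0 (trans (*-congʳ x≈0) (zeroˡ y)) (·-IsZeroˡ v a≈0)

  ·-Proportional : ∀ {t} (a b v : Vec Carrier n) → Proportional t a b → b · v ≈ t * (a · v)
  ·-Proportional {t = t} []      []      []      []               = sym (zeroʳ t)
  ·-Proportional {t = t} (x ∷ a) (y ∷ b) (z ∷ v) (y≈tx ∷ b≈ta) = begin
    y * z + b · v              ≈⟨ +-cong (*-congʳ y≈tx) (·-Proportional a b v b≈ta) ⟩
    t * x * z + t * (a · v)    ≈⟨ +-congʳ (*-assoc t x z) ⟩
    t * (x * z) + t * (a · v)  ≈⟨ distribˡ t _ _ ⟨
    t * (x * z + a · v)        ∎

  ·-lincomb : ∀ l m (a b v : Vec Carrier n) → lincomb l m a b · v ≈ l * (a · v) + m * (b · v)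
  ·-lincomb l m []      []      []      = sym (+-pres-≈0 (zeroʳ l) (zeroʳ m))
  ·-lincomb l m (x ∷ a) (y ∷ b) (z ∷ v) = begin
    (l * x + m * y) * z + lincomb l m a b · v
      ≈⟨ +-cong (distribʳ z _ _) (·-lincomb l m a b v) ⟩
    (l * x * z + m * y * z) + (l * (a · v) + m * (b · v))
      ≈⟨ +-congʳ (+-cong (*-assoc l x z) (*-assoc m y z)) ⟩
    (l * (x * z) + m * (y * z)) + (l * (a · v) + m * (b · v))
      ≈⟨ interchange _ _ _ _ ⟩
    (l * (x * z) + l * (a · v)) + (m * (y * z) + m * (b · v))
      ≈⟨ +-cong (distribˡ l _ _) (distribˡ m _ _) ⟨
    l * (x * z + a · v) + m * (y * z + b · v)
      ∎

  IsZero-lincomb⇒LinearRelation : ∀ {l m} (a b : Vec Carrier n) →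
                                  IsZero (lincomb l m a b) → LinearRelation l m a b
  IsZero-lincomb⇒LinearRelation []      []      []        = []
  IsZero-lincomb⇒LinearRelation (x ∷ a) (y ∷ b) (e ∷ rel) = e ∷ IsZero-lincomb⇒LinearRelation a b rel

  IsZero⇒LinearRelation : ∀ l m → IsZero a → IsZero b → LinearRelation l m a b
  IsZero⇒LinearRelation l m []          []          = []
  IsZero⇒LinearRelation l m (x≈0 ∷ a≈0) (y≈0 ∷ b≈0) =
    +-pres-≈0 (*-presʳ-≈0 l x≈0) (*-presʳ-≈0 m y≈0) ∷ IsZero⇒LinearRelation l m a≈0 b≈0

  LinearRelation-sym : ∀ {l m} → LinearRelation l m a b → LinearRelation m l b a
  LinearRelation-sym = Pointwise.sym (trans (+-comm _ _))

  m≈0⇒l≈0 : ∀ {l m} → m ≈ 0# → ¬ IsZero a → LinearRelation l m a b → l ≈ 0#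
  m≈0⇒l≈0 {l = l} {m} m≈0 a≉0 rel with l ≟ 0#
  ... | yes l≈0 = l≈0
  ... | no l≉0  = ⊥-elim (a≉0 (Pointwiseˡ⇒All (Pointwise.map lx≈0 rel)))
    where
    lx≈0 : ∀ {x y} → l * x + m * y ≈ 0# → x ≈ 0#
    lx≈0 {x} {y} e = h*x≈0⇒x≈0 l≉0 (begin
      l * x           ≈⟨ +-identityʳ (l * x) ⟨
      l * x + 0#      ≈⟨ +-congˡ (*-presʳ-≈0 y m≈0 ) ⟨
      l * x + y * m   ≈⟨ +-congˡ (*-comm y m) ⟩
      l * x + m * y   ≈⟨ e ⟩
      0#              ∎)

  l≈0⇒m≈0 : ∀ {l m} → l ≈ 0# → ¬ IsZero b → LinearRelation l m a b → m ≈ 0#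
  l≈0⇒m≈0 l≈0 b≉0 rel = m≈0⇒l≈0 l≈0 b≉0 (LinearRelation-sym rel)

  Independent-sym : Independent a b → Independent b a
  Independent-sym ind rel = swap (ind (LinearRelation-sym rel))

  Independent-tail : ∀ {h k} → h ≈ 0# → k ≈ 0# → Independent (h ∷ a) (k ∷ b) → Independent a b
  Independent-tail h≈0 k≈0 ind rel = ind (+-pres-≈0 (*-presʳ-≈0 _ h≈0) (*-presʳ-≈0 _ k≈0) ∷ rel)

  Independent⇒¬IsZeroˡ : Independent a b → ¬ IsZero a
  Independent⇒¬IsZeroˡ ind a≈0 =
    1≉0 (proj₁ (ind (Pointwise.map (λ x≈0 → +-pres-≈0 (*-presʳ-≈0 1# x≈0) (zeroˡ _))
                                   (All⇒Pointwiseˡ a≈0))))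

  ¬Independent₁ : ∀ x y → ¬ Independent (x ∷ []) (y ∷ [])
  ¬Independent₁ x y ind with x ≟ 0#
  ... | yes x≈0 = Independent⇒¬IsZeroˡ ind (x≈0 ∷ [])
  ... | no x≉0  = x≉0 (-x≈0⇒x≈0 (proj₂ (ind (y*x+-x*y≈0 x y ∷ []))))

  Independent⊎Proportional : ∀ (a b : Vec Carrier n) → ¬ IsZero a →
                             Independent a b ⊎ ∃ λ t → Proportional t a b
  Independent⊎Proportional a b a≉0
    with Any.any? (λ t → Pointwise.decidable (λ x y → y ≟ (t * x)) a b) elements
  ... | yes ∃t = inj₂ (Any.satisfied ∃t)
  ... | no ∄t  = inj₁ independent
    where
    independent : Independent a b
    independent {l} {m} rel with m ≟ 0#
    ... | yes m≈0 = m≈0⇒l≈0 m≈0 a≉0 rel , m≈0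
    ... | no m≉0  = ⊥-elim (∄t (Any.map (λ t₀≈t → Pointwise.map (λ y≈t₀x → trans y≈t₀x (*-congʳ t₀≈t))
                                                                b≈t₀a)
                                         (complete t₀)))
      where
      t₀ = - (inv m m≉0 * l)
      y≈t₀x : ∀ {x y} → l * x + m * y ≈ 0# → y ≈ t₀ * x
      y≈t₀x {x} {y} e = begin
        y                        ≈⟨ inv-cancelˡ m≉0 y ⟨
        inv m m≉0 * (m * y)      ≈⟨ *-congˡ (+-inverseʳ-unique (l * x) (m * y) e) ⟩
        inv m m≉0 * - (l * x)    ≈⟨ -‿distribʳ-* _ _ ⟨
        - (inv m m≉0 * (l * x))  ≈⟨ -‿cong (*-assoc _ l x) ⟨
        - (inv m m≉0 * l * x)    ≈⟨ -‿distribˡ-* _ x ⟩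
        t₀ * x                   ∎
      b≈t₀a : Proportional t₀ a b
      b≈t₀a = Pointwise.map y≈t₀x rel

  normalized⇒¬IsZero : ∀ {v : Vec Carrier n} → Normalized v → ¬ IsZero v
  normalized⇒¬IsZero {v = x ∷ v} (inj₁ x≈1)         (x≈0 ∷ _)   = 1≉0 (trans (sym x≈1) x≈0)
  normalized⇒¬IsZero {v = x ∷ v} (inj₂ (_ , v-nor)) (_   ∷ v≈0) = normalized⇒¬IsZero v-nor v≈0

  Pointwise⇒≋ : ∀ {u v : Vec Carrier n} → Pointwise _≈_ u v → u ≋ v
  Pointwise⇒≋ []           = lift tt
  Pointwise⇒≋ (x≈y ∷ u≈v) = x≈y , Pointwise⇒≋ u≈v

  ≋-sym : ∀ (u v : Vec Carrier n) → u ≋ v → v ≋ u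
  ≋-sym []      []      _           = lift tt
  ≋-sym (x ∷ u) (y ∷ v) (x≈y , u≋v) = sym x≈y , ≋-sym u v u≋v

  private
    leading-1-0 : ∀ {h k l m} (H K : Vec Carrier n) → h ≈ 1# → k ≈ 0# → ¬ IsZero K →
                  LinearRelation l m (h ∷ H) (k ∷ K) → l ≈ 0# × m ≈ 0#
    leading-1-0 {h = h} {k} {l} {m} H K h≈1 k≈0 K≉0 rel@(e ∷ _) = l≈0 , l≈0⇒m≈0 l≈0 kK≉0 rel
      where
      kK≉0 : ¬ IsZero (k ∷ K)
      kK≉0 (_ ∷ K≈0) = K≉0 K≈0
      l≈0 : l ≈ 0#
      l≈0 = begin
        l              ≈⟨ *-identityʳ l ⟨
        l * 1#         ≈⟨ *-congˡ h≈1 ⟨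
        l * h          ≈⟨ +-identityʳ _ ⟨
        l * h + 0#     ≈⟨ +-congˡ (*-presʳ-≈0 m k≈0) ⟨
        l * h + m * k  ≈⟨ e ⟩
        0#             ∎

    leading-1-1 : ∀ {h k l m} (H K : Vec Carrier n) → h ≈ 1# → k ≈ 1# → ¬ H ≋ K →
                  LinearRelation l m (h ∷ H) (k ∷ K) → l ≈ 0# × m ≈ 0#
    leading-1-1 {h = h} {k} {l} {m} H K h≈1 k≈1 H≉K rel@(e ∷ rel′) with l ≟ 0#
    ... | yes l≈0 = l≈0 , l≈0⇒m≈0 l≈0 (λ { (k≈0 ∷ _) → 1≉0 (trans (sym k≈1) k≈0) }) rel
    ... | no l≉0  = ⊥-elim (H≉K (Pointwise⇒≋ (Pointwise.map x≈y rel′)))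
      where
      m≈-l : m ≈ - l
      m≈-l = +-inverseʳ-unique l m (trans (+-cong (trans (sym (*-identityʳ l)) (*-congˡ (sym h≈1)))
                                                 (trans (sym (*-identityʳ m)) (*-congˡ (sym k≈1)))) e)
      x≈y : ∀ {x y} → l * x + m * y ≈ 0# → x ≈ y
      x≈y {x} {y} e′ = *-cancelˡ l≉0 (x∙y⁻¹≈ε⇒x≈y (l * x) (l * y)
        (trans (+-congˡ (trans (-‿distribˡ-* l y) (*-congʳ (sym m≈-l)))) e′))

  distinct-normalized⇒Independent : ∀ (H K : Vec Carrier n) → Normalized H → Normalized K → ¬ H ≋ K →
                                    Independent H K
  distinct-normalized⇒Independent (h ∷ H) (k ∷ K) (inj₁ h≈1) (inj₁ k≈1) hH≉kK =
    leading-1-1 H K h≈1 k≈1 (λ H≋K → hH≉kK (trans h≈1 (sym k≈1) , H≋K))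
  distinct-normalized⇒Independent (h ∷ H) (k ∷ K) (inj₁ h≈1) (inj₂ (k≈0 , K-nor)) _ =
    leading-1-0 H K h≈1 k≈0 (normalized⇒¬IsZero K-nor)
  distinct-normalized⇒Independent (h ∷ H) (k ∷ K) (inj₂ (h≈0 , H-nor)) (inj₁ k≈1) _ =
    Independent-sym (leading-1-0 K H k≈1 h≈0 (normalized⇒¬IsZero H-nor))
  distinct-normalized⇒Independent (h ∷ H) (k ∷ K) (inj₂ (h≈0 , H-nor)) (inj₂ (k≈0 , K-nor)) hH≉kK
                                  (_ ∷ rel) =
    distinct-normalized⇒Independent H K H-nor K-nor (λ H≋K → hH≉kK (trans h≈0 (sym k≈0) , H≋K)) rel

module SolutionCounts {c ℓ} (F : FiniteField c ℓ) where
  open FiniteField F hiding (refl)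
  open Projective F
  open FieldLemmas F
  open FieldSums F
  open LinearAlgebra F
  open import Algebra.Properties.Ring ring
    using (x≈z//y; //-rightDividesˡ; -‿distribˡ-*; -‿distribʳ-*; +-inverseʳ-unique)

  𝟙-≟-drop : ∀ {x} y c → x ≈ 0# → 𝟙 ((x + y) ≟ c) ≡ 𝟙 (y ≟ c)
  𝟙-≟-drop y c x≈0 = 𝟙-cong (trans (sym x+y≈y)) (trans x+y≈y) _ _
    where x+y≈y = trans (+-congʳ x≈0) (+-identityˡ _)

  𝟙-≟-affine-resp : ∀ k y d → (λ x → 𝟙 ((k * x + y) ≟ d)) Preserves _≈_ ⟶ _≡_
  𝟙-≟-affine-resp k y d x≈x′ =
    𝟙-cong (trans (+-congʳ (*-congˡ (sym x≈x′)))) (trans (+-congʳ (*-congˡ x≈x′))) _ _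

  𝟙-≟-at1 : ∀ h y → 𝟙 ((h * 1# + y) ≟ 0#) ≡ 𝟙 (y ≟ (- h))
  𝟙-≟-at1 h y = 𝟙-cong (λ e → trans (+-inverseʳ-unique _ y e) (-‿cong (*-identityʳ h)))
                       (λ y≈-h → trans (+-cong (*-identityʳ h) y≈-h) (-‿inverseʳ h)) _ _

  count-solutions₁ : ∀ m (a : Vec Carrier (suc m)) c → ¬ IsZero a →
                     ∑V (suc m) (λ v → 𝟙 ((a · v) ≟ c)) ≡ order ^ m
  count-solutions₁ m (h ∷ a) c ha≉0 with h ≟ 0#
  ... | no h≉0 = begin
    ∑[ x ← elements ] ∑V m (λ w → 𝟙 ((h * x + a · w) ≟ c))
      ≡⟨ ∑-∑V-comm elements m _ ⟩
    ∑V m (λ w → ∑[ x ← elements ] 𝟙 ((h * x + a · w) ≟ c))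
      ≡⟨ ∑V-cong m (λ w → ∑-𝟙-root h≉0 (a · w) c) ⟩
    ∑V m (λ _ → 1)
      ≡⟨ ∑V-const m 1 ⟩
    order ^ m ℕ.* 1
      ≡⟨ ℕₚ.*-identityʳ _ ⟩
    order ^ m
      ∎
    where open ≡-Reasoning
  count-solutions₁ zero    (h ∷ []) c ha≉0 | yes h≈0 = ⊥-elim (ha≉0 (h≈0 ∷ []))
  count-solutions₁ (suc m) (h ∷ a)  c ha≉0 | yes h≈0 = ≡.trans
    (∑-cong elements (λ x → ≡.trans
      (∑V-cong (suc m) (λ w → 𝟙-≟-drop (a · w) c (*-presˡ-≈0 x h≈0)))
      (count-solutions₁ m a c (λ a≈0 → ha≉0 (h≈0 ∷ a≈0)))))
    (∑-const elements _)

  private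
    eliminate : ∀ k i c A B → k * (i * (c - A)) + B ≈ ((- (k * i)) * A + 1# * B) + k * i * c
    eliminate k i c A B = begin
      k * (i * (c - A)) + B            ≈⟨ +-congʳ (*-assoc k i _) ⟨
      t * (c - A) + B                  ≈⟨ +-congʳ (distribˡ t c (- A)) ⟩
      (t * c + t * (- A)) + B          ≈⟨ +-congʳ (+-congˡ (-‿distribʳ-* t A)) ⟨
      (t * c + - (t * A)) + B          ≈⟨ +-cong (+-congˡ (-‿distribˡ-* t A)) (sym (*-identityˡ B)) ⟩
      (t * c + (- t) * A) + 1# * B     ≈⟨ +-assoc _ _ _ ⟩
      t * c + ((- t) * A + 1# * B)     ≈⟨ +-comm _ _ ⟩
      ((- t) * A + 1# * B) + t * c     ∎
      where
      t = k * i
      open import Relation.Binary.Reasoning.Setoid setoid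

    eliminate-head : ∀ {h} (h≉0 : h ≉ 0#) k → (- (k * inv h h≉0)) * h + 1# * k ≈ 0#
    eliminate-head {h} h≉0 k = begin
      (- (k * i)) * h + 1# * k  ≈⟨ +-cong (sym (-‿distribˡ-* (k * i) h)) (*-identityˡ k) ⟩
      - (k * i * h) + k         ≈⟨ +-congʳ (-‿cong (*-assoc k i h)) ⟩
      - (k * (i * h)) + k       ≈⟨ +-congʳ (-‿cong (*-congˡ (inv-inverseˡ h≉0))) ⟩
      - (k * 1#) + k            ≈⟨ +-congʳ (-‿cong (*-identityʳ k)) ⟩
      - k + k                   ≈⟨ -‿inverseˡ k ⟩
      0#                        ∎
      where
      i = inv h h≉0
      open import Relation.Binary.Reasoning.Setoid setoid

    -- Solving the first equation for x and substituting into the second leaves one equation in w,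
    -- whose coefficient vector b - (k / h) a is nonzero by independence.
    count-solutions₂-head≉0 : ∀ m {h k} (a b : Vec Carrier (suc m)) c d →
      h ≉ 0# → Independent (h ∷ a) (k ∷ b) →
      ∑V (suc (suc m)) (λ v → 𝟙 (((h ∷ a) · v) ≟ c) ℕ.* 𝟙 (((k ∷ b) · v) ≟ d)) ≡ order ^ m
    count-solutions₂-head≉0 m {h} {k} a b c d h≉0 ind = begin
      ∑[ x ← elements ] ∑V (suc m) (λ w → 𝟙 ((h * x + a · w) ≟ c) ℕ.* 𝟙 ((k * x + b · w) ≟ d))
        ≡⟨ ∑-∑V-comm elements (suc m) (λ x w → 𝟙 ((h * x + a · w) ≟ c) ℕ.* 𝟙 ((k * x + b · w) ≟ d)) ⟩
      ∑V (suc m) (λ w → ∑[ x ← elements ] (𝟙 ((h * x + a · w) ≟ c) ℕ.* 𝟙 ((k * x + b · w) ≟ d)))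
        ≡⟨ ∑V-cong (suc m) (λ w → ∑-root h≉0 (a · w) c (λ x → 𝟙 ((k * x + b · w) ≟ d))
                                                        (𝟙-≟-affine-resp k (b · w) d)) ⟩
      ∑V (suc m) (λ w → 𝟙 ((k * root h h≉0 (a · w) c + b · w) ≟ d))
        ≡⟨ ∑V-cong (suc m) (λ w → 𝟙-cong (eliminated w) (uneliminated w) (_ ≟ d) (_ ≟ (d - t * c))) ⟩
      ∑V (suc m) (λ w → 𝟙 ((u · w) ≟ (d - t * c)))
        ≡⟨ count-solutions₁ m u (d - t * c) u≉0 ⟩
      order ^ m
        ∎
      where
      open ≡-Reasoning
      i = inv h h≉0
      t = k * i
      u = lincomb (- t) 1# a b
      u≉0 : ¬ IsZero u
      u≉0 u≈0 = 1≉0 (proj₂ (ind (eliminate-head h≉0 k ∷ IsZero-lincomb⇒LinearRelation a b u≈0)))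
      eliminated : ∀ w → k * root h h≉0 (a · w) c + b · w ≈ d → u · w ≈ d - t * c
      eliminated w e = trans (·-lincomb (- t) 1# a b w)
                             (x≈z//y _ _ d (trans (sym (eliminate k i c (a · w) (b · w))) e))
      uneliminated : ∀ w → u · w ≈ d - t * c → k * root h h≉0 (a · w) c + b · w ≈ d
      uneliminated w e = trans (eliminate k i c (a · w) (b · w))
        (trans (+-congʳ (trans (sym (·-lincomb (- t) 1# a b w)) e)) (//-rightDividesˡ _ d))

  count-solutions₂ : ∀ m (a b : Vec Carrier (suc (suc m))) c d → Independent a b →
                     ∑V (suc (suc m)) (λ v → 𝟙 ((a · v) ≟ c) ℕ.* 𝟙 ((b · v) ≟ d)) ≡ order ^ m
  count-solutions₂ m (h ∷ a) (k ∷ b) c d ind with h ≟ 0# | k ≟ 0#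
  ... | no h≉0 | _      = count-solutions₂-head≉0 m a b c d h≉0 ind
  ... | yes _  | no k≉0 = ≡.trans
    (∑V-cong (suc (suc m)) (λ v → ℕₚ.*-comm (𝟙 (((h ∷ a) · v) ≟ c)) (𝟙 (((k ∷ b) · v) ≟ d))))
    (count-solutions₂-head≉0 m b a d c k≉0 (Independent-sym ind))
  count-solutions₂ zero    (h ∷ x ∷ []) (k ∷ y ∷ []) c d ind | yes h≈0 | yes k≈0 =
    ⊥-elim (¬Independent₁ x y (Independent-tail h≈0 k≈0 ind))
  count-solutions₂ (suc m) (h ∷ a) (k ∷ b) c d ind | yes h≈0 | yes k≈0 = ≡.trans
    (∑-cong elements (λ x → ≡.trans
      (∑V-cong (suc (suc m)) (λ w → cong₂ ℕ._*_ (𝟙-≟-drop (a · w) c (*-presˡ-≈0 x h≈0))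
                                                (𝟙-≟-drop (b · w) d (*-presˡ-≈0 x k≈0))))
      (count-solutions₂ m a b c d (Independent-tail h≈0 k≈0 ind))))
    (∑-const elements _)

module PointCounts {c ℓ} (F : FiniteField c ℓ) where
  open FiniteField F hiding (refl)
  open Projective F
  open FieldLemmas F
  open FieldSums F
  open LinearAlgebra F
  open SolutionCounts F
  open import Algebra.Properties.Ring ring using (-1*x≈-x)

  ∑P : ∀ n → (Vec Carrier n → ℕ) → ℕ
  ∑P n g = ∑V n (λ v → 𝟙 (normalized? v) ℕ.* g v)

  ∑P-cong : ∀ n {f g : Vec Carrier n → ℕ} → (∀ v → f v ≡ g v) → ∑P n f ≡ ∑P n g
  ∑P-cong n f≗g = ∑V-cong n (λ v → cong (𝟙 (normalized? v) ℕ.*_) (f≗g v))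

  ∑P-congᴺ : ∀ n {f g : Vec Carrier n → ℕ} → (∀ v → Normalized v → f v ≡ g v) → ∑P n f ≡ ∑P n g
  ∑P-congᴺ n f≗g = ∑V-cong n (λ v → 𝟙-guard (normalized? v) (f≗g v))

  ∑P-+ : ∀ n (f g : Vec Carrier n → ℕ) → ∑P n (λ v → f v ℕ.+ g v) ≡ ∑P n f ℕ.+ ∑P n g
  ∑P-+ n f g = ≡.trans (∑V-cong n (λ v → ℕₚ.*-distribˡ-+ (𝟙 (normalized? v)) (f v) (g v))) (∑V-+ n _ _)

  ∑P-*ʳ : ∀ n k (f : Vec Carrier n → ℕ) → ∑P n (λ v → f v ℕ.* k) ≡ ∑P n f ℕ.* k
  ∑P-*ʳ n k f = ≡.trans (∑V-cong n (λ v → ≡.sym (ℕₚ.*-assoc (𝟙 (normalized? v)) (f v) k))) (∑V-*ʳ n k _)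

  ∑P-∑-comm : ∀ {a} {A : Set a} n (xs : List A) (f : A → Vec Carrier n → ℕ) →
              ∑P n (λ v → ∑[ x ← xs ] f x v) ≡ ∑[ x ← xs ] ∑P n (f x)
  ∑P-∑-comm n xs f = ≡.trans (∑V-cong n (λ v → ≡.sym (∑-*ˡ xs (𝟙 (normalized? v)) (λ x → f x v))))
                             (≡.sym (∑-∑V-comm xs n _))

  𝟙-normalized : ∀ {n} x (w : Vec Carrier n) →
                 𝟙 (normalized? (x ∷ w)) ≡ 𝟙 (x ≟ 1#) ℕ.+ 𝟙 (x ≟ 0#) ℕ.* 𝟙 (normalized? w)
  𝟙-normalized x w = ≡.trans
    (𝟙-⊎-disjoint (λ (x≈1 , x≈0 , _) → 0≉1 (trans (sym x≈0) x≈1))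
                  (x ≟ 1#) ((x ≟ 0#) ×-dec normalized? w))
    (cong (𝟙 (x ≟ 1#) ℕ.+_) (𝟙-× (x ≟ 0#) (normalized? w)))

  ∑P-split : ∀ n (g : Vec Carrier (suc n) → ℕ) →
             (∀ w → (λ x → g (x ∷ w)) Preserves _≈_ ⟶ _≡_) →
             ∑P (suc n) g ≡ ∑V n (λ w → g (1# ∷ w)) ℕ.+ ∑P n (λ w → g (0# ∷ w))
  ∑P-split n g g-resp = begin
    ∑[ x ← elements ] ∑P-at x
      ≡⟨ ∑-cong elements split ⟩
    ∑[ x ← elements ] (𝟙 (x ≟ 1#) ℕ.* ∑V n (g-at x) ℕ.+ 𝟙 (x ≟ 0#) ℕ.* ∑P n (g-at x))
      ≡⟨ ∑-+ elements _ _ ⟩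
    ∑[ x ← elements ] (𝟙 (x ≟ 1#) ℕ.* ∑V n (g-at x))
      ℕ.+ ∑[ x ← elements ] (𝟙 (x ≟ 0#) ℕ.* ∑P n (g-at x))
      ≡⟨ cong₂ ℕ._+_ (∑-delta 1# _ (λ x≈y → ∑V-cong n (λ w → g-resp w x≈y)))
                     (∑-delta 0# _ (λ x≈y → ∑P-cong n (λ w → g-resp w x≈y))) ⟩
    ∑V n (g-at 1#) ℕ.+ ∑P n (g-at 0#)
      ∎
    where
    open ≡-Reasoning
    g-at : Carrier → Vec Carrier n → ℕ
    g-at x w = g (x ∷ w)
    ∑P-at : Carrier → ℕ
    ∑P-at x = ∑V n (λ w → 𝟙 (normalized? (x ∷ w)) ℕ.* g-at x w)
    expand : ∀ p q r s → (p ℕ.+ q ℕ.* r) ℕ.* s ≡ p ℕ.* s ℕ.+ q ℕ.* (r ℕ.* s)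
    expand = solve-∀
    split : ∀ x → ∑P-at x ≡ 𝟙 (x ≟ 1#) ℕ.* ∑V n (g-at x) ℕ.+ 𝟙 (x ≟ 0#) ℕ.* ∑P n (g-at x)
    split x = begin
      ∑P-at x
        ≡⟨ ∑V-cong n (λ w → ≡.trans (cong (ℕ._* g-at x w) (𝟙-normalized x w))
                                    (expand (𝟙 (x ≟ 1#)) (𝟙 (x ≟ 0#)) (𝟙 (normalized? w)) (g-at x w))) ⟩
      ∑V n (λ w → 𝟙 (x ≟ 1#) ℕ.* g-at x w ℕ.+ 𝟙 (x ≟ 0#) ℕ.* (𝟙 (normalized? w) ℕ.* g-at x w))
        ≡⟨ ∑V-+ n _ _ ⟩
      ∑V n (λ w → 𝟙 (x ≟ 1#) ℕ.* g-at x w)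
        ℕ.+ ∑V n (λ w → 𝟙 (x ≟ 0#) ℕ.* (𝟙 (normalized? w) ℕ.* g-at x w))
        ≡⟨ cong₂ ℕ._+_ (∑V-*ˡ n (𝟙 (x ≟ 1#)) (g-at x))
                       (∑V-*ˡ n (𝟙 (x ≟ 0#)) (λ w → 𝟙 (normalized? w) ℕ.* g-at x w)) ⟩
      𝟙 (x ≟ 1#) ℕ.* ∑V n (g-at x) ℕ.+ 𝟙 (x ≟ 0#) ℕ.* ∑P n (g-at x)
        ∎

  count-points : ∀ n → ∑P n (λ _ → 1) ≡ θ order n
  count-points zero    = refl
  count-points (suc n) = ≡.trans
    (∑P-split n (λ _ → 1) (λ _ _ → refl))
    (cong₂ ℕ._+_ (≡.trans (∑V-const n 1) (ℕₚ.*-identityʳ _)) (count-points n))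

  length-filter-points : ∀ n {p} {P : Vec Carrier (suc n) → Set p} (P? : ∀ v → Dec (P v)) →
                         length (filter P? (points n)) ≡ ∑P (suc n) (λ v → 𝟙 (P? v))
  length-filter-points n P? = begin
    length (filter P? (points n))
      ≡⟨ length-filter≡∑𝟙 P? (points n) ⟩
    ∑[ v ← filter normalized? (allVecs (suc n)) ] 𝟙 (P? v)
      ≡⟨ ∑-filter normalized? (allVecs (suc n)) _ ⟩
    ∑[ v ← allVecs (suc n) ] (𝟙 (normalized? v) ℕ.* 𝟙 (P? v))
      ≡⟨ ∑-allVecs (suc n) _ ⟩
    ∑P (suc n) (λ v → 𝟙 (P? v))
      ∎
    where open ≡-Reasoning

  pointsOn : ∀ {n} → Vec Carrier n → ℕ
  pointsOn {n} a = ∑P n (λ v → 𝟙 ((a · v) ≟ 0#))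

  pointsOnBoth : ∀ {n} → Vec Carrier n → Vec Carrier n → ℕ
  pointsOnBoth {n} a b = ∑P n (λ v → 𝟙 ((a · v) ≟ 0#) ℕ.* 𝟙 ((b · v) ≟ 0#))

  affinePointsOnBoth : ∀ {n} → Carrier → Carrier → Vec Carrier n → Vec Carrier n → ℕ
  affinePointsOnBoth {n} h k a b = ∑V n (λ w → 𝟙 ((a · w) ≟ (- h)) ℕ.* 𝟙 ((b · w) ≟ (- k)))

  split-pointsOn : ∀ {m} h (a : Vec Carrier m) →
                   pointsOn (h ∷ a) ≡ ∑V m (λ w → 𝟙 ((a · w) ≟ (- h))) ℕ.+ pointsOn a
  split-pointsOn {m} h a = ≡.trans
    (∑P-split m (λ v → 𝟙 (((h ∷ a) · v) ≟ 0#)) (λ w → 𝟙-≟-affine-resp h (a · w) 0#))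
    (cong₂ ℕ._+_ (∑V-cong m (λ w → 𝟙-≟-at1 h (a · w)))
                 (∑P-cong m (λ w → 𝟙-≟-drop (a · w) 0# (zeroʳ h))))

  split-pointsOnBoth : ∀ {m} h k (a b : Vec Carrier m) →
                       pointsOnBoth (h ∷ a) (k ∷ b) ≡ affinePointsOnBoth h k a b ℕ.+ pointsOnBoth a b
  split-pointsOnBoth {m} h k a b = ≡.trans
    (∑P-split m (λ v → 𝟙 (((h ∷ a) · v) ≟ 0#) ℕ.* 𝟙 (((k ∷ b) · v) ≟ 0#))
      (λ w x≈y → cong₂ ℕ._*_ (𝟙-≟-affine-resp h (a · w) 0# x≈y)
                             (𝟙-≟-affine-resp k (b · w) 0# x≈y)))
    (cong₂ ℕ._+_
      (∑V-cong m (λ w → cong₂ ℕ._*_ (𝟙-≟-at1 h (a · w)) (𝟙-≟-at1 k (b · w))))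
      (∑P-cong m (λ w → cong₂ ℕ._*_ (𝟙-≟-drop (a · w) 0# (zeroʳ h))
                                    (𝟙-≟-drop (b · w) 0# (zeroʳ k)))))

  𝟙-≟-IsZero : ∀ {n h} {a : Vec Carrier n} → IsZero a → ∀ w → 𝟙 ((a · w) ≟ (- h)) ≡ 𝟙 (0# ≟ (- h))
  𝟙-≟-IsZero a≈0 w = 𝟙-cong (trans (sym (·-IsZeroˡ w a≈0))) (trans (·-IsZeroˡ w a≈0)) _ _

  count-pointsOn : ∀ m (a : Vec Carrier (suc m)) → ¬ IsZero a → pointsOn a ≡ θ order m
  count-pointsOn m (h ∷ a) ha≉0 with isZero? a
  ... | yes a≈0 = ≡.trans (split-pointsOn h a) (cong₂ ℕ._+_
    (∑V-zero m (λ w → ≡.trans (𝟙-≟-IsZero a≈0 w) (𝟙-no (λ 0≈-h → h≉0 (-x≈0⇒x≈0 (sym 0≈-h))) _)))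
    (≡.trans (∑P-cong m (λ w → 𝟙-yes (·-IsZeroˡ w a≈0) _)) (count-points m)))
    where
    h≉0 : h ≉ 0#
    h≉0 h≈0 = ha≉0 (h≈0 ∷ a≈0)
  count-pointsOn zero    (h ∷ []) ha≉0 | no a≉0 = ⊥-elim (a≉0 [])
  count-pointsOn (suc m) (h ∷ a)  ha≉0 | no a≉0 = ≡.trans (split-pointsOn h a)
    (cong₂ ℕ._+_ (count-solutions₁ m a (- h) a≉0) (count-pointsOn m a a≉0))

  pointsOnBoth-proportional : ∀ {n t} (a b : Vec Carrier n) → Proportional t a b →
                              pointsOnBoth a b ≡ pointsOn a
  pointsOnBoth-proportional {t = t} a b b≈ta = ∑P-cong _ (λ w →
    ≡.trans (≡.sym (𝟙-× ((a · w) ≟ 0#) ((b · w) ≟ 0#)))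
            (𝟙-cong proj₁ (λ a·w≈0 → a·w≈0 , trans (·-Proportional a b w b≈ta) (*-presʳ-≈0 t a·w≈0))
                    (((a · w) ≟ 0#) ×-dec ((b · w) ≟ 0#)) ((a · w) ≟ 0#)))

  count-pointsOnBoth : ∀ m (a b : Vec Carrier (suc (suc m))) → Independent a b →
                       pointsOnBoth a b ≡ θ order m

  private
    module _ {m h k} {a b : Vec Carrier (suc m)} (ind : Independent (h ∷ a) (k ∷ b)) where

      tails-IsZero : IsZero a → affinePointsOnBoth h k a b ℕ.+ pointsOnBoth a b ≡ θ order m
      tails-IsZero a≈0 = cong₂ ℕ._+_
        (∑V-zero (suc m) (λ w → cong (ℕ._* 𝟙 ((b · w) ≟ (- k))) (≡.trans (𝟙-≟-IsZero a≈0 w)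
          (𝟙-no (λ 0≈-h → h≉0 (-x≈0⇒x≈0 (sym 0≈-h))) (0# ≟ (- h))))))
        (≡.trans (∑P-cong (suc m) (λ w → ≡.trans
                   (cong (ℕ._* 𝟙 ((b · w) ≟ 0#)) (𝟙-yes (·-IsZeroˡ w a≈0) ((a · w) ≟ 0#)))
                   (ℕₚ.*-identityˡ _)))
                 (count-pointsOn m b b≉0))
        where
        h≉0 : h ≉ 0#
        h≉0 h≈0 = Independent⇒¬IsZeroˡ ind (h≈0 ∷ a≈0)
        b≉0 : ¬ IsZero b
        b≉0 b≈0 =
          h≉0 (-x≈0⇒x≈0 (proj₂ (ind (y*x+-x*y≈0 h k ∷ IsZero⇒LinearRelation k (- h) a≈0 b≈0))))

      -- If b = t a, a common affine point 1 ∷ w would give the relation t (h ∷ a) - (k ∷ b) = 0.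
      tails-Proportional : ∀ {t} → ¬ IsZero a → Proportional t a b →
                           affinePointsOnBoth h k a b ℕ.+ pointsOnBoth a b ≡ θ order m
      tails-Proportional {t} a≉0 b≈ta = cong₂ ℕ._+_
        (∑V-zero (suc m) (λ w → 𝟙*𝟙≡0 (no-affine-point w) (_ ≟ (- h)) (_ ≟ (- k))))
        (≡.trans (pointsOnBoth-proportional a b b≈ta) (count-pointsOn m a a≉0))
        where
        no-affine-point : ∀ w → ¬ (a · w ≈ - h × b · w ≈ - k)
        no-affine-point w (a·w≈-h , b·w≈-k) =
          1≉0 (-x≈0⇒x≈0 (proj₂ (ind (head ∷ Pointwise.map tail b≈ta))))
          where
          head : t * h + (- 1#) * k ≈ 0#
          head = begin
            t * h + (- 1#) * k   ≈⟨ +-congˡ (-1*x≈-x k) ⟩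
            t * h + - k          ≈⟨ +-congˡ (trans (sym (·-Proportional a b w b≈ta)) b·w≈-k) ⟨
            t * h + t * (a · w)  ≈⟨ distribˡ t h (a · w) ⟨
            t * (h + a · w)      ≈⟨ *-presʳ-≈0 t (trans (+-congˡ a·w≈-h) (-‿inverseʳ h)) ⟩
            0#                   ∎
            where open import Relation.Binary.Reasoning.Setoid setoid
          tail : ∀ {x y} → y ≈ t * x → t * x + (- 1#) * y ≈ 0#
          tail y≈tx = trans (+-congˡ (trans (-1*x≈-x _) (-‿cong y≈tx))) (-‿inverseʳ _)

    tails-Independent : ∀ m {h k} (a b : Vec Carrier (suc m)) → Independent a b →
                        affinePointsOnBoth h k a b ℕ.+ pointsOnBoth a b ≡ θ order m
    tails-Independent zero    (x ∷ []) (y ∷ []) ind = ⊥-elim (¬Independent₁ x y ind)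
    tails-Independent (suc m) {h} {k} a b ind =
      cong₂ ℕ._+_ (count-solutions₂ m a b (- h) (- k) ind) (count-pointsOnBoth m a b ind)

  count-pointsOnBoth m (h ∷ a) (k ∷ b) ind = ≡.trans (split-pointsOnBoth h k a b) (tails (isZero? a))
    where
    tails : Dec (IsZero a) → affinePointsOnBoth h k a b ℕ.+ pointsOnBoth a b ≡ θ order m
    tails (yes a≈0) = tails-IsZero ind a≈0
    tails (no a≉0)  = [ tails-Independent m a b , (λ (t , b≈ta) → tails-Proportional ind a≉0 b≈ta) ]′
                        (Independent⊎Proportional a b a≉0)

module Incidences {c ℓ} (F : FiniteField c ℓ) {m : ℕ} where
  open FiniteField F hiding (refl)
  open Projective F
  open FieldSums F
  open LinearAlgebra F
  open PointCounts F

  private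
    Point = Vec Carrier (suc (suc m))

    rearrange : ∀ x y z → (x ℕ.+ y) ℕ.+ z ≡ x ℕ.+ (z ℕ.+ y)
    rearrange = solve-∀

    left-comm : ∀ x y z → x ℕ.+ (y ℕ.+ z) ≡ y ℕ.+ (x ℕ.+ z)
    left-comm = solve-∀

  pointsOnBoth-self : ∀ {Φ} → Normalized Φ → pointsOnBoth Φ Φ ≡ θ order (suc m)
  pointsOnBoth-self {Φ} Φ-nor =
    ≡.trans (∑P-cong (suc (suc m)) (λ v → 𝟙-idem ((Φ · v) ≟ 0#)))
            (count-pointsOn (suc m) Φ (normalized⇒¬IsZero Φ-nor))

  pointsOnBoth-distinct : ∀ {Φ H} → Normalized Φ → Normalized H → ¬ Φ ≋ H → pointsOnBoth Φ H ≡ θ order m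
  pointsOnBoth-distinct {Φ} {H} Φ-nor H-nor Φ≉H =
    count-pointsOnBoth m Φ H (distinct-normalized⇒Independent Φ H Φ-nor H-nor Φ≉H)

  ∑-pointsOnBoth : ∀ {Φ} (hs : List Point) → All Normalized hs → AllPairs (λ H K → ¬ H ≋ K) hs → Φ ∈ hs →
    ∑[ H ← hs ] pointsOnBoth Φ H ℕ.+ θ order m ≡ θ order (suc m) ℕ.+ length hs ℕ.* θ order m
  ∑-pointsOnBoth {Φ} (Φ ∷ hs) (Φ-nor ∷ hs-nor) (Φ≉hs ∷ _) (here refl) = begin
    (pointsOnBoth Φ Φ ℕ.+ ∑[ H ← hs ] pointsOnBoth Φ H) ℕ.+ θ order m
      ≡⟨ cong₂ (λ x y → (x ℕ.+ y) ℕ.+ θ order m) (pointsOnBoth-self Φ-nor)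
               (∑-constOn hs (θ order m) (All.zipWith (λ (H-nor , Φ≉H) → pointsOnBoth-distinct Φ-nor H-nor Φ≉H)
                                                      (hs-nor , Φ≉hs))) ⟩
    (θ order (suc m) ℕ.+ length hs ℕ.* θ order m) ℕ.+ θ order m
      ≡⟨ rearrange (θ order (suc m)) (length hs ℕ.* θ order m) (θ order m) ⟩
    θ order (suc m) ℕ.+ (θ order m ℕ.+ length hs ℕ.* θ order m)
      ∎
    where open ≡-Reasoning
  ∑-pointsOnBoth {Φ} (H ∷ hs) (H-nor ∷ hs-nor) (H≉hs ∷ hs-distinct) (there Φ∈hs) = begin
    (pointsOnBoth Φ H ℕ.+ ∑[ K ← hs ] pointsOnBoth Φ K) ℕ.+ θ order m
      ≡⟨ cong (λ x → (x ℕ.+ _) ℕ.+ θ order m) (pointsOnBoth-distinct Φ-nor H-nor Φ≉H) ⟩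
    (θ order m ℕ.+ ∑[ K ← hs ] pointsOnBoth Φ K) ℕ.+ θ order m
      ≡⟨ ℕₚ.+-assoc (θ order m) _ _ ⟩
    θ order m ℕ.+ (∑[ K ← hs ] pointsOnBoth Φ K ℕ.+ θ order m)
      ≡⟨ cong (θ order m ℕ.+_) (∑-pointsOnBoth hs hs-nor hs-distinct Φ∈hs) ⟩
    θ order m ℕ.+ (θ order (suc m) ℕ.+ length hs ℕ.* θ order m)
      ≡⟨ left-comm (θ order m) (θ order (suc m)) (length hs ℕ.* θ order m) ⟩
    θ order (suc m) ℕ.+ (θ order m ℕ.+ length hs ℕ.* θ order m)
      ∎
    where
    open ≡-Reasoning
    Φ-nor : Normalized Φ
    Φ-nor = All.lookup hs-nor Φ∈hs
    Φ≉H : ¬ Φ ≋ H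
    Φ≉H Φ≋H = All.lookup H≉hs Φ∈hs (≋-sym Φ H Φ≋H)

module DoubleCounting {c ℓ} (F : FiniteField c ℓ) {m : ℕ} (Ω : Projective.HyperplaneFamily F (suc m))
                     {Φ : Vec (FiniteField.Carrier F) (suc (suc m))} (Φ∈Ω : Φ ∈ Projective.HyperplaneFamily.members Ω)
                     where
  open FiniteField F hiding (refl)
  open Projective F
  open FieldSums F
  open LinearAlgebra F
  open PointCounts F
  open Incidences F
  open HyperplaneFamily Ω

  Φ-nor : Normalized Φ
  Φ-nor = All.lookup normal Φ∈Ω

  double-count : ∑P (suc (suc m)) (λ v → 𝟙 ((Φ · v) ≟ 0#) ℕ.* degree v) ℕ.+ θ order m ≡
                 θ order (suc m) ℕ.+ size ℕ.* θ order m
  double-count = ≡.trans (cong (ℕ._+ θ order m) exchange) (∑-pointsOnBoth members normal noRepeats Φ∈Ω)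
    where
    exchange : ∑P (suc (suc m)) (λ v → 𝟙 ((Φ · v) ≟ 0#) ℕ.* degree v) ≡ ∑[ H ← members ] pointsOnBoth Φ H
    exchange = ≡.trans
      (∑P-cong (suc (suc m)) (λ v → ≡.trans
        (cong (𝟙 ((Φ · v) ≟ 0#) ℕ.*_) (length-filter≡∑𝟙 (λ H → incident? H v) members))
        (≡.sym (∑-*ˡ members (𝟙 ((Φ · v) ≟ 0#)) (λ H → 𝟙 ((H · v) ≟ 0#))))))
      (∑P-∑-comm (suc (suc m)) members (λ H v → 𝟙 ((Φ · v) ≟ 0#) ℕ.* 𝟙 ((H · v) ≟ 0#)))

  module _ {p} {Black : Vec Carrier (suc (suc m)) → Set p} (black? : ∀ v → Dec (Black v)) where

    blackOnΦ whiteOnΦ : Vec Carrier (suc (suc m)) → ℕ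
    blackOnΦ v = 𝟙 (black? v ×-dec incident? Φ v)
    whiteOnΦ v = 𝟙 (¬? (black? v) ×-dec incident? Φ v)

    blacks whites : ℕ
    blacks = ∑P (suc (suc m)) blackOnΦ
    whites = ∑P (suc (suc m)) whiteOnΦ

    blacks+whites : blacks ℕ.+ whites ≡ θ order (suc m)
    blacks+whites = begin
      blacks ℕ.+ whites                                   ≡⟨ ∑P-+ (suc (suc m)) blackOnΦ whiteOnΦ ⟨
      ∑P (suc (suc m)) (λ v → blackOnΦ v ℕ.+ whiteOnΦ v)  ≡⟨ ∑P-cong (suc (suc m)) partition ⟩
      pointsOn Φ                                          ≡⟨ count-pointsOn (suc m) Φ (normalized⇒¬IsZero Φ-nor) ⟩
      θ order (suc m)                                     ∎
      where
      open ≡-Reasoning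
      partition : ∀ v → blackOnΦ v ℕ.+ whiteOnΦ v ≡ 𝟙 ((Φ · v) ≟ 0#)
      partition v = 𝟙-×-partition (black? v) (incident? Φ v)

    ∑-degree-two-valued : ∀ k₁ k₂ →
      (∀ v → Normalized v → (Black v → degree v ≡ k₁) × (¬ Black v → degree v ≡ k₂)) →
      ∑P (suc (suc m)) (λ v → 𝟙 ((Φ · v) ≟ 0#) ℕ.* degree v) ≡ blacks ℕ.* k₁ ℕ.+ whites ℕ.* k₂
    ∑-degree-two-valued k₁ k₂ two-valued = begin
      ∑P (suc (suc m)) (λ v → 𝟙 ((Φ · v) ≟ 0#) ℕ.* degree v)
        ≡⟨ ∑P-congᴺ (suc (suc m)) (λ v v-nor → 𝟙-×-two-valued k₁ k₂ (black? v) (incident? Φ v)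
             (λ _ → proj₁ (two-valued v v-nor)) (λ _ → proj₂ (two-valued v v-nor))) ⟩
      ∑P (suc (suc m)) (λ v → blackOnΦ v ℕ.* k₁ ℕ.+ whiteOnΦ v ℕ.* k₂)
        ≡⟨ ∑P-+ (suc (suc m)) (λ v → blackOnΦ v ℕ.* k₁) (λ v → whiteOnΦ v ℕ.* k₂) ⟩
      ∑P (suc (suc m)) (λ v → blackOnΦ v ℕ.* k₁) ℕ.+ ∑P (suc (suc m)) (λ v → whiteOnΦ v ℕ.* k₂)
        ≡⟨ cong₂ ℕ._+_ (∑P-*ʳ (suc (suc m)) k₁ blackOnΦ) (∑P-*ʳ (suc (suc m)) k₂ whiteOnΦ) ⟩
      blacks ℕ.* k₁ ℕ.+ whites ℕ.* k₂
        ∎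
      where open ≡-Reasoning

module Arithmetic where
  open import Data.Integer as ℤ using (ℤ; +_)
  import Data.Integer.Properties as ℤₚ
  import Data.Integer.Tactic.RingSolver as ℤ-Ring
  open import Data.Rational as ℚ using (ℚ)
  import Data.Rational.Properties as ℚₚ
  open import Data.Rational.Unnormalised as ℚᵘ using (mkℚᵘ; *≡*)
  import Data.Rational.Unnormalised.Properties as ℚᵘₚ

  ι : ℤ → ℚ
  ι z = z ℚ./ 1

  private
    toℚᵘ-ι : ∀ z → ℚ.toℚᵘ (ι z) ℚᵘ.≃ mkℚᵘ z 0
    toℚᵘ-ι z = ℚₚ.toℚᵘ-fromℚᵘ (mkℚᵘ z 0)

  ι-+ : ∀ a b → ι (a ℤ.+ b) ≡ ι a ℚ.+ ι b
  ι-+ a b = ℚₚ.toℚᵘ-injective (ℚᵘₚ.≃-trans (toℚᵘ-ι (a ℤ.+ b)) (ℚᵘₚ.≃-trans (*≡* (denominators a b))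
    (ℚᵘₚ.≃-sym (ℚᵘₚ.≃-trans (ℚₚ.toℚᵘ-homo-+ (ι a) (ι b))
                             (ℚᵘₚ.+-cong (toℚᵘ-ι a) (toℚᵘ-ι b))))))
    where
    denominators : ∀ a b → (a ℤ.+ b) ℤ.* + 1 ≡ (a ℤ.* + 1 ℤ.+ b ℤ.* + 1) ℤ.* + 1
    denominators = ℤ-Ring.solve-∀

  ι-* : ∀ a b → ι (a ℤ.* b) ≡ ι a ℚ.* ι b
  ι-* a b = ℚₚ.toℚᵘ-injective (ℚᵘₚ.≃-trans (toℚᵘ-ι (a ℤ.* b)) (ℚᵘₚ.≃-trans (*≡* refl)
    (ℚᵘₚ.≃-sym (ℚᵘₚ.≃-trans (ℚₚ.toℚᵘ-homo-* (ι a) (ι b))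
                             (ℚᵘₚ.*-cong (toℚᵘ-ι a) (toℚᵘ-ι b))))))

  ι-neg : ∀ a → ι (ℤ.- a) ≡ ℚ.- ι a
  ι-neg a = ℚₚ.toℚᵘ-injective (ℚᵘₚ.≃-trans (toℚᵘ-ι (ℤ.- a))
    (ℚᵘₚ.≃-sym (ℚᵘₚ.≃-trans (ℚₚ.toℚᵘ-homo‿- (ι a)) (ℚᵘₚ.-‿cong (toℚᵘ-ι a)))))

  ι-- : ∀ a b → ι (a ℤ.- b) ≡ ι a ℚ.- ι b
  ι-- a b = ≡.trans (ι-+ a (ℤ.- b)) (cong (ι a ℚ.+_) (ι-neg b))

  ι-injective : ∀ {a b} → ι a ≡ ι b → a ≡ b
  ι-injective {a} {b} ιa≡ιb
    with ℚᵘₚ.≃-trans (ℚᵘₚ.≃-sym (toℚᵘ-ι a)) (ℚᵘₚ.≃-trans (ℚₚ.toℚᵘ-cong ιa≡ιb) (toℚᵘ-ι b))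
  ... | *≡* a*1≡b*1 = ≡.trans (≡.sym (ℤₚ.*-identityʳ a)) (≡.trans a*1≡b*1 (ℤₚ.*-identityʳ b))

  ℕtoℚ-injective : ∀ {m n} → ℕtoℚ m ≡ ℕtoℚ n → m ≡ n
  ℕtoℚ-injective = ℤₚ.+-injective ∘ ι-injective

  ι-/ℕ : ∀ z n {{_ : ℕ.NonZero n}} → ι (z ℤ.* + n) /ℕ n ≡ ι z
  ι-/ℕ z (suc r) = ℚₚ.toℚᵘ-injective
    (ℚᵘₚ.≃-trans (ℚₚ.toℚᵘ-homo-* (ι (z ℤ.* + suc r)) (+ 1 ℚ./ suc r))
    (ℚᵘₚ.≃-trans (ℚᵘₚ.*-cong (toℚᵘ-ι (z ℤ.* + suc r)) (ℚₚ.toℚᵘ-fromℚᵘ (mkℚᵘ (+ 1) r)))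
                 (ℚᵘₚ.≃-trans (*≡* cross) (ℚᵘₚ.≃-sym (toℚᵘ-ι z)))))
    where
    cross : (z ℤ.* + suc r) ℤ.* + 1 ℤ.* + 1 ≡ z ℤ.* + suc (ℕ.pred (1 ℕ.* suc r))
    cross = ≡.trans (≡.trans (ℤₚ.*-identityʳ _) (ℤₚ.*-identityʳ _))
                    (cong (λ t → z ℤ.* + t) (≡.sym (ℕₚ.+-identityʳ (suc r))))

  /-exact : ∀ k d → + (k ℕ.* suc d) ℚ./ suc d ≡ ι (+ k)
  /-exact k d = ℚₚ.fromℚᵘ-cong {mkℚᵘ (+ (k ℕ.* suc d)) d} {mkℚᵘ (+ k) 0}
                               (*≡* (≡.trans (ℤₚ.*-identityʳ _) (ℤₚ.pos-* k (suc d))))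

  negOnePow²≡1 : ∀ n → negOnePow n ℤ.* negOnePow n ≡ + 1
  negOnePow²≡1 zero    = refl
  negOnePow²≡1 (suc n) = ≡.trans (neg*neg (negOnePow n)) (negOnePow²≡1 n)
    where
    neg*neg : ∀ e → (ℤ.- e) ℤ.* (ℤ.- e) ≡ e ℤ.* e
    neg*neg = ℤ-Ring.solve-∀

  -- altQuot q′ n = (q ^ n - (-1) ^ n) / (q + 1), where q = suc q′.
  altQuot : ℕ → ℕ → ℕ
  altQuot q′ zero          = 0
  altQuot q′ (suc zero)    = 1
  altQuot q′ (suc (suc n)) = suc q′ ^ n ℕ.* q′ ℕ.+ altQuot q′ n

  altQuot-spec : ∀ q′ n → + (suc q′ ^ n) ℤ.- negOnePow n ≡ + (altQuot q′ n ℕ.* suc (suc q′))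
  altQuot-spec q′ zero          = refl
  altQuot-spec q′ (suc zero)    = cong +_ (q*1+1≡1*[1+q] (suc q′))
    where
    q*1+1≡1*[1+q] : ∀ q → q ℕ.* 1 ℕ.+ 1 ≡ 1 ℕ.* suc q
    q*1+1≡1*[1+q] = solve-∀
  altQuot-spec q′ (suc (suc n)) = begin
    + (q ℕ.* (q ℕ.* q ^ n)) ℤ.- ℤ.- ℤ.- negOnePow n
      ≡⟨ cong (ℤ._- ℤ.- ℤ.- negOnePow n) (≡.trans (ℤₚ.pos-* q (q ℕ.* q ^ n))
                                                   (cong (+ q ℤ.*_) (ℤₚ.pos-* q (q ^ n)))) ⟩
    + q ℤ.* (+ q ℤ.* + (q ^ n)) ℤ.- ℤ.- ℤ.- negOnePow n
      ≡⟨ two-steps (+ (q ^ n)) (negOnePow n) (+ q′) ⟩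
    + (q ^ n) ℤ.* + q′ ℤ.* + (2 ℕ.+ q′) ℤ.+ (+ (q ^ n) ℤ.- negOnePow n)
      ≡⟨ cong (λ t → + (q ^ n) ℤ.* + q′ ℤ.* + (2 ℕ.+ q′) ℤ.+ t) (altQuot-spec q′ n) ⟩
    + (q ^ n) ℤ.* + q′ ℤ.* + (2 ℕ.+ q′) ℤ.+ + (altQuot q′ n ℕ.* (2 ℕ.+ q′))
      ≡⟨ to-ℕ (q ^ n) q′ (altQuot q′ n) (2 ℕ.+ q′) ⟩
    + ((q ^ n ℕ.* q′ ℕ.+ altQuot q′ n) ℕ.* (2 ℕ.+ q′))
      ∎
    where
    open ≡-Reasoning
    q = suc q′
    two-steps : ∀ x e k → (+ 1 ℤ.+ k) ℤ.* ((+ 1 ℤ.+ k) ℤ.* x) ℤ.- ℤ.- ℤ.- e ≡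
                          x ℤ.* k ℤ.* (+ 2 ℤ.+ k) ℤ.+ (x ℤ.- e)
    two-steps = ℤ-Ring.solve-∀
    to-ℕ : ∀ x k a b → + x ℤ.* + k ℤ.* + b ℤ.+ + (a ℕ.* b) ≡ + ((x ℕ.* k ℕ.+ a) ℕ.* b)
    to-ℕ x k a b = begin
      + x ℤ.* + k ℤ.* + b ℤ.+ + (a ℕ.* b)  ≡⟨ cong (λ y → y ℤ.* + b ℤ.+ + (a ℕ.* b)) (ℤₚ.pos-* x k) ⟨
      + (x ℕ.* k) ℤ.* + b ℤ.+ + (a ℕ.* b)  ≡⟨ cong (ℤ._+ + (a ℕ.* b)) (ℤₚ.pos-* (x ℕ.* k) b) ⟨
      + (x ℕ.* k ℕ.* b ℕ.+ a ℕ.* b)       ≡⟨ cong +_ (ℕₚ.*-distribʳ-+ b (x ℕ.* k) a) ⟨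
      + ((x ℕ.* k ℕ.+ a) ℕ.* b)           ∎

  blackDegree whiteDegree : ℕ → ℕ → ℕ
  blackDegree q′ m = suc q′ ^ suc m ℕ.* altQuot q′ m
  whiteDegree q′ m = suc q′ ^ m ℕ.* altQuot q′ (suc m)

  private
    scaled : ∀ x q′ n → + x ℤ.* (+ (suc q′ ^ n) ℤ.- negOnePow n) ≡
                        + (x ℕ.* altQuot q′ n ℕ.* suc (suc q′))
    scaled x q′ n = begin
      + x ℤ.* (+ (suc q′ ^ n) ℤ.- negOnePow n)     ≡⟨ cong (+ x ℤ.*_) (altQuot-spec q′ n) ⟩
      + x ℤ.* + (altQuot q′ n ℕ.* suc (suc q′))    ≡⟨ ℤₚ.pos-* x _ ⟨
      + (x ℕ.* (altQuot q′ n ℕ.* suc (suc q′)))    ≡⟨ cong +_ (ℕₚ.*-assoc x _ _) ⟨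
      + (x ℕ.* altQuot q′ n ℕ.* suc (suc q′))      ∎
      where open ≡-Reasoning

  kBlack≡blackDegree : ∀ q′ m → kBlack (suc q′) (suc m) ≡ ℕtoℚ (blackDegree q′ m)
  kBlack≡blackDegree q′ m = ≡.trans
    (cong (λ z → z ℚ./ suc (suc q′)) (scaled (suc q′ ^ suc m) q′ m)) (/-exact (blackDegree q′ m) (suc q′))

  kWhite≡whiteDegree : ∀ q′ m → kWhite (suc q′) (suc m) ≡ ℕtoℚ (whiteDegree q′ m)
  kWhite≡whiteDegree q′ m = ≡.trans
    (cong (λ z → z ℚ./ suc (suc q′)) (scaled (suc q′ ^ m) q′ (suc m))) (/-exact (whiteDegree q′ m) (suc q′))

  blackDegree≡whiteDegree+ : ∀ q′ m →
    + blackDegree q′ m ≡ + whiteDegree q′ m ℤ.+ negOnePow (suc m) ℤ.* + (suc q′ ^ m)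
  blackDegree≡whiteDegree+ q′ m = ℤₚ.*-cancelʳ-≡ _ _ (+ suc q) (begin
    + blackDegree q′ m ℤ.* + suc q
      ≡⟨ ≡.trans (≡.sym (ℤₚ.pos-* (blackDegree q′ m) (suc q))) (≡.sym (scaled (q ^ suc m) q′ m)) ⟩
    + (q ^ suc m) ℤ.* (+ a ℤ.- e)
      ≡⟨ cong (λ x → x ℤ.* (+ a ℤ.- e)) (ℤₚ.pos-* q a) ⟩
    + q ℤ.* + a ℤ.* (+ a ℤ.- e)
      ≡⟨ expand (+ q) (+ a) e ⟩
    + a ℤ.* (+ q ℤ.* + a ℤ.- ℤ.- e) ℤ.+ (ℤ.- e) ℤ.* + a ℤ.* (+ 1 ℤ.+ + q)
      ≡⟨ cong (λ x → + a ℤ.* (x ℤ.- ℤ.- e) ℤ.+ (ℤ.- e) ℤ.* + a ℤ.* + suc q) (ℤₚ.pos-* q a) ⟨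
    + a ℤ.* (+ (q ^ suc m) ℤ.- ℤ.- e) ℤ.+ (ℤ.- e) ℤ.* + a ℤ.* + suc q
      ≡⟨ cong (λ x → x ℤ.+ (ℤ.- e) ℤ.* + a ℤ.* + suc q)
              (≡.trans (scaled a q′ (suc m)) (ℤₚ.pos-* (whiteDegree q′ m) (suc q))) ⟩
    + whiteDegree q′ m ℤ.* + suc q ℤ.+ (ℤ.- e) ℤ.* + a ℤ.* + suc q
      ≡⟨ ℤₚ.*-distribʳ-+ (+ suc q) (+ whiteDegree q′ m) ((ℤ.- e) ℤ.* + a) ⟨
    (+ whiteDegree q′ m ℤ.+ (ℤ.- e) ℤ.* + a) ℤ.* + suc q
      ∎)
    where
    open ≡-Reasoning
    q = suc q′
    a = q ^ m
    e = negOnePow m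
    expand : ∀ q a e → q ℤ.* a ℤ.* (a ℤ.- e) ≡
                       a ℤ.* (q ℤ.* a ℤ.- ℤ.- e) ℤ.+ (ℤ.- e) ℤ.* a ℤ.* (+ 1 ℤ.+ q)
    expand = ℤ-Ring.solve-∀

  θ-geometric : ∀ Q n → θ (suc Q) n ℕ.* Q ℕ.+ 1 ≡ suc Q ^ n
  θ-geometric Q zero    = refl
  θ-geometric Q (suc n) = begin
    (suc Q ^ n ℕ.+ θ (suc Q) n) ℕ.* Q ℕ.+ 1        ≡⟨ regroup (suc Q ^ n) (θ (suc Q) n) Q ⟩
    suc Q ^ n ℕ.* Q ℕ.+ (θ (suc Q) n ℕ.* Q ℕ.+ 1)  ≡⟨ cong (suc Q ^ n ℕ.* Q ℕ.+_) (θ-geometric Q n) ⟩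
    suc Q ^ n ℕ.* Q ℕ.+ suc Q ^ n                  ≡⟨ collect (suc Q ^ n) Q ⟩
    suc Q ^ suc n                                  ∎
    where
    open ≡-Reasoning
    regroup : ∀ x t Q → (x ℕ.+ t) ℕ.* Q ℕ.+ 1 ≡ x ℕ.* Q ℕ.+ (t ℕ.* Q ℕ.+ 1)
    regroup = solve-∀
    collect : ∀ x Q → x ℕ.* Q ℕ.+ x ≡ suc Q ℕ.* x
    collect = solve-∀

  θ-/ℕ : ∀ q″ n → let q = suc (suc q″) in
         ℕtoℚ (q ^ (2 ℕ.* n) ∸ 1) /ℕ (q ^ 2 ∸ 1) ≡ ℕtoℚ (θ (q ^ 2) n)
  θ-/ℕ q″ n = begin
    ℕtoℚ (q ^ (2 ℕ.* n) ∸ 1) /ℕ Q₀            ≡⟨ cong (λ x → ℕtoℚ (x ∸ 1) /ℕ Q₀) (ℕₚ.^-*-assoc q 2 n) ⟨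
    ℕtoℚ ((q ^ 2) ^ n ∸ 1) /ℕ Q₀              ≡⟨ cong (λ x → ℕtoℚ (x ∸ 1) /ℕ Q₀) (θ-geometric Q₀ n) ⟨
    ℕtoℚ (θ (q ^ 2) n ℕ.* Q₀ ℕ.+ 1 ∸ 1) /ℕ Q₀  ≡⟨ cong (λ x → ℕtoℚ x /ℕ Q₀) (ℕₚ.m+n∸n≡m (θ (q ^ 2) n ℕ.* Q₀) 1) ⟩
    ι (+ (θ (q ^ 2) n ℕ.* Q₀)) /ℕ Q₀          ≡⟨ cong (λ x → ι x /ℕ Q₀) (ℤₚ.pos-* (θ (q ^ 2) n) Q₀) ⟩
    ι (+ θ (q ^ 2) n ℤ.* + Q₀) /ℕ Q₀          ≡⟨ ι-/ℕ (+ θ (q ^ 2) n) Q₀ ⟩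
    ℕtoℚ (θ (q ^ 2) n)                        ∎
    where
    open ≡-Reasoning
    q  = suc (suc q″)
    Q₀ = q ^ 2 ∸ 1

  solve-for-blacks : ∀ (e B W K₁ K₂ T₀ T₁ N a : ℤ) → e ℤ.* e ≡ + 1 →
    B ℤ.* K₁ ℤ.+ W ℤ.* K₂ ℤ.+ T₁ ≡ T₀ ℤ.+ N ℤ.* T₁ → B ℤ.+ W ≡ T₀ → K₁ ≡ K₂ ℤ.+ e ℤ.* a →
    e ℤ.* ((N ℤ.- + 1) ℤ.* T₁ ℤ.- T₀ ℤ.* (K₂ ℤ.- + 1)) ≡ B ℤ.* a
  solve-for-blacks e B W _ K₂ _ T₁ N a e²≡1 incidences refl refl = begin
    e ℤ.* ((N ℤ.- + 1) ℤ.* T₁ ℤ.- (B ℤ.+ W) ℤ.* (K₂ ℤ.- + 1))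
      ≡⟨ regroup e N T₁ B W K₂ ⟩
    e ℤ.* ((B ℤ.+ W ℤ.+ N ℤ.* T₁) ℤ.- T₁ ℤ.- (B ℤ.+ W) ℤ.* K₂)
      ≡⟨ cong (λ x → e ℤ.* (x ℤ.- T₁ ℤ.- (B ℤ.+ W) ℤ.* K₂)) incidences ⟨
    e ℤ.* ((B ℤ.* (K₂ ℤ.+ e ℤ.* a) ℤ.+ W ℤ.* K₂ ℤ.+ T₁) ℤ.- T₁ ℤ.- (B ℤ.+ W) ℤ.* K₂)
      ≡⟨ cancel e B W K₂ a T₁ ⟩
    e ℤ.* e ℤ.* (B ℤ.* a)
      ≡⟨ cong (ℤ._* (B ℤ.* a)) e²≡1 ⟩
    + 1 ℤ.* (B ℤ.* a)
      ≡⟨ ℤₚ.*-identityˡ _ ⟩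
    B ℤ.* a
      ∎
    where
    open ≡-Reasoning
    regroup : ∀ e N T₁ B W K₂ → e ℤ.* ((N ℤ.- + 1) ℤ.* T₁ ℤ.- (B ℤ.+ W) ℤ.* (K₂ ℤ.- + 1)) ≡
                                e ℤ.* ((B ℤ.+ W ℤ.+ N ℤ.* T₁) ℤ.- T₁ ℤ.- (B ℤ.+ W) ℤ.* K₂)
    regroup = ℤ-Ring.solve-∀
    cancel : ∀ e B W K₂ a T₁ →
             e ℤ.* ((B ℤ.* (K₂ ℤ.+ e ℤ.* a) ℤ.+ W ℤ.* K₂ ℤ.+ T₁) ℤ.- T₁ ℤ.- (B ℤ.+ W) ℤ.* K₂) ≡ e ℤ.* e ℤ.* (B ℤ.* a)
    cancel = ℤ-Ring.solve-∀

  ι-blackCount : ∀ e n t₁ t₀ k₂ → ι (e ℤ.* ((n ℤ.- + 1) ℤ.* t₁ ℤ.- t₀ ℤ.* (k₂ ℤ.- + 1))) ≡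
                 ι e ℚ.* ((ι n ℚ.- ℚ.1ℚ) ℚ.* ι t₁ ℚ.- ι t₀ ℚ.* (ι k₂ ℚ.- ℚ.1ℚ))
  ι-blackCount e n t₁ t₀ k₂ = begin
    ι (e ℤ.* ((n ℤ.- + 1) ℤ.* t₁ ℤ.- t₀ ℤ.* (k₂ ℤ.- + 1)))
      ≡⟨ ι-* e ((n ℤ.- + 1) ℤ.* t₁ ℤ.- t₀ ℤ.* (k₂ ℤ.- + 1)) ⟩
    ι e ℚ.* ι ((n ℤ.- + 1) ℤ.* t₁ ℤ.- t₀ ℤ.* (k₂ ℤ.- + 1))
      ≡⟨ cong (ι e ℚ.*_) (ι-- ((n ℤ.- + 1) ℤ.* t₁) (t₀ ℤ.* (k₂ ℤ.- + 1))) ⟩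
    ι e ℚ.* (ι ((n ℤ.- + 1) ℤ.* t₁) ℚ.- ι (t₀ ℤ.* (k₂ ℤ.- + 1)))
      ≡⟨ cong (ι e ℚ.*_) (cong₂ ℚ._-_ (ι-* (n ℤ.- + 1) t₁) (ι-* t₀ (k₂ ℤ.- + 1))) ⟩
    ι e ℚ.* (ι (n ℤ.- + 1) ℚ.* ι t₁ ℚ.- ι t₀ ℚ.* ι (k₂ ℤ.- + 1))
      ≡⟨ cong (ι e ℚ.*_) (cong₂ (λ x y → x ℚ.* ι t₁ ℚ.- ι t₀ ℚ.* y) (ι-- n (+ 1)) (ι-- k₂ (+ 1))) ⟩
    ι e ℚ.* ((ι n ℚ.- ℚ.1ℚ) ℚ.* ι t₁ ℚ.- ι t₀ ℚ.* (ι k₂ ℚ.- ℚ.1ℚ))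
      ∎
    where open ≡-Reasoning

  blackCount≡ι : ∀ q″ m N → let q = suc (suc q″) in
    blackCount q (suc m) N ≡
    ι (negOnePow (suc m) ℤ.* ((+ N ℤ.- + 1) ℤ.* + θ (q ^ 2) m
                             ℤ.- + θ (q ^ 2) (suc m) ℤ.* (+ whiteDegree (suc q″) m ℤ.- + 1))) /ℕ (q ^ m)
  blackCount≡ι q″ m N = begin
    blackCount q (suc m) N
      ≡⟨ cong₂ (λ x y → (ι ε ℚ.* ((ℕtoℚ N ℚ.- ℚ.1ℚ) ℚ.* x ℚ.- y ℚ.* (kWhite q (suc m) ℚ.- ℚ.1ℚ))) /ℕ a)
               θ₁ (θ-/ℕ q″ (suc m)) ⟩
    (ι ε ℚ.* ((ℕtoℚ N ℚ.- ℚ.1ℚ) ℚ.* ℕtoℚ T₁ ℚ.- ℕtoℚ T₀ ℚ.* (kWhite q (suc m) ℚ.- ℚ.1ℚ))) /ℕ a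
      ≡⟨ cong (λ k → (ι ε ℚ.* ((ℕtoℚ N ℚ.- ℚ.1ℚ) ℚ.* ℕtoℚ T₁ ℚ.- ℕtoℚ T₀ ℚ.* (k ℚ.- ℚ.1ℚ))) /ℕ a)
              (kWhite≡whiteDegree (suc q″) m) ⟩
    (ι ε ℚ.* ((ℕtoℚ N ℚ.- ℚ.1ℚ) ℚ.* ℕtoℚ T₁ ℚ.- ℕtoℚ T₀ ℚ.* (ℕtoℚ K₂ ℚ.- ℚ.1ℚ))) /ℕ a
      ≡⟨ cong (_/ℕ a) (ι-blackCount ε (+ N) (+ T₁) (+ T₀) (+ K₂)) ⟨
    ι (ε ℤ.* ((+ N ℤ.- + 1) ℤ.* + T₁ ℤ.- + T₀ ℤ.* (+ K₂ ℤ.- + 1))) /ℕ a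
      ∎
    where
    open ≡-Reasoning
    q  = suc (suc q″)
    a  = q ^ m
    ε  = negOnePow (suc m)
    T₀ = θ (q ^ 2) (suc m)
    T₁ = θ (q ^ 2) m
    K₂ = whiteDegree (suc q″) m
    θ₁ : ℕtoℚ (q ^ (2 ℕ.* suc m ∸ 2) ∸ 1) /ℕ (q ^ 2 ∸ 1) ≡ ℕtoℚ T₁
    θ₁ = ≡.trans (cong (λ k → ℕtoℚ (q ^ k ∸ 1) /ℕ (q ^ 2 ∸ 1)) (cong (_∸ 2) (ℕₚ.*-suc 2 m))) (θ-/ℕ q″ m)

  blackCount-solution : ∀ q″ m N b w {Q} → let q = suc (suc q″) in Q ≡ q ^ 2 →
    b ℕ.* blackDegree (suc q″) m ℕ.+ w ℕ.* whiteDegree (suc q″) m ℕ.+ θ Q m ≡ θ Q (suc m) ℕ.+ N ℕ.* θ Q m →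
    b ℕ.+ w ≡ θ Q (suc m) →
    ℕtoℚ b ≡ blackCount q (suc m) N
  blackCount-solution q″ m N b w refl incidences partition = begin
    ℕtoℚ b
      ≡⟨ ι-/ℕ (+ b) a {{ℕₚ.m^n≢0 q m}} ⟨
    ι (+ b ℤ.* + a) /ℕ a
      ≡⟨ cong (λ z → ι z /ℕ a) (solve-for-blacks ε (+ b) (+ w) (+ K₁) (+ K₂) (+ T₀) (+ T₁) (+ N) (+ a)
           (negOnePow²≡1 (suc m)) incidencesℤ (cong +_ partition) (blackDegree≡whiteDegree+ (suc q″) m)) ⟨
    ι (ε ℤ.* ((+ N ℤ.- + 1) ℤ.* + T₁ ℤ.- + T₀ ℤ.* (+ K₂ ℤ.- + 1))) /ℕ a
      ≡⟨ blackCount≡ι q″ m N ⟨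
    blackCount q (suc m) N
      ∎
    where
    open ≡-Reasoning
    q  = suc (suc q″)
    a  = q ^ m
    ε  = negOnePow (suc m)
    T₀ = θ (q ^ 2) (suc m)
    T₁ = θ (q ^ 2) m
    K₁ = blackDegree (suc q″) m
    K₂ = whiteDegree (suc q″) m
    incidencesℤ : + b ℤ.* + K₁ ℤ.+ + w ℤ.* + K₂ ℤ.+ + T₁ ≡ + T₀ ℤ.+ + N ℤ.* + T₁
    incidencesℤ = begin
      + b ℤ.* + K₁ ℤ.+ + w ℤ.* + K₂ ℤ.+ + T₁
        ≡⟨ cong₂ (λ x y → x ℤ.+ y ℤ.+ + T₁) (ℤₚ.pos-* b K₁) (ℤₚ.pos-* w K₂) ⟨
      + (b ℕ.* K₁ ℕ.+ w ℕ.* K₂ ℕ.+ T₁)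
        ≡⟨ cong +_ incidences ⟩
      + (T₀ ℕ.+ N ℕ.* T₁)
        ≡⟨ cong (λ x → + T₀ ℤ.+ x) (ℤₚ.pos-* N T₁) ⟩
      + T₀ ℤ.+ + N ℤ.* + T₁
        ∎

module DegreeValues {c ℓ} (F : FiniteField c ℓ) (q′ m : ℕ) (Ω : Projective.HyperplaneFamily F (suc m)) where
  open Arithmetic using (ℕtoℚ-injective; blackDegree; whiteDegree; kBlack≡blackDegree; kWhite≡whiteDegree)
  open Projective F
  open HyperplaneFamily Ω
  open ProjectiveCounts F (suc q′) (suc m)

  black-or-white⇒degrees :
    (∀ v → Normalized v → ℕtoℚ (degree v) ≡ kBlack (suc q′) (suc m) ⊎ ℕtoℚ (degree v) ≡ kWhite (suc q′) (suc m)) →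
    ∀ v → Normalized v →
    (Black Ω v → degree v ≡ blackDegree q′ m) × (¬ Black Ω v → degree v ≡ whiteDegree q′ m)
  black-or-white⇒degrees black-or-white v v-nor = black⇒ , ¬black⇒
    where
    black⇒ : Black Ω v → degree v ≡ blackDegree q′ m
    black⇒ black = ℕtoℚ-injective {degree v} {blackDegree q′ m} (≡.trans black (kBlack≡blackDegree q′ m))
    ¬black⇒ : ¬ Black Ω v → degree v ≡ whiteDegree q′ m
    ¬black⇒ ¬black = [ ⊥-elim ∘ ¬black , white⇒ ]′ (black-or-white v v-nor)
      where
      white⇒ : ℕtoℚ (degree v) ≡ kWhite (suc q′) (suc m) → degree v ≡ whiteDegree q′ m
      white⇒ white = ℕtoℚ-injective {degree v} {whiteDegree q′ m} (≡.trans white (kWhite≡whiteDegree q′ m))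

mainTheorem5 : ∀ {c ℓ : Level} (F : FiniteField c ℓ) (q s : ℕ) →
    IsPrimePower q → q > 2 → s ≥ 3 → FiniteField.order F ≡ q ^ 2 →
    (Ω : Projective.HyperplaneFamily F s) →
    Projective.HyperplaneFamily.size Ω ≥ 1 →
    (∀ (P : Vec (FiniteField.Carrier F) (suc s)) → Projective.Normalized F P →
      (ℕtoℚ (Projective.HyperplaneFamily.degree Ω P) ≡ kBlack q s)
      ⊎ (ℕtoℚ (Projective.HyperplaneFamily.degree Ω P) ≡ kWhite q s)) →
    ∀ Φ → Φ ∈ Projective.HyperplaneFamily.members Ω →
    ℕtoℚ (ProjectiveCounts.blackPointsIn F q s Ω Φ)
      ≡ blackCount q s (Projective.HyperplaneFamily.size Ω)
mainTheorem5 F zero           _       _ ()       _  _ _ _ _ _ _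
mainTheorem5 F (suc zero)     _       _ (s≤s ()) _  _ _ _ _ _ _
mainTheorem5 F (suc (suc _))  zero    _ _        () _ _ _ _ _ _
mainTheorem5 F (suc (suc q″)) (suc m) _ _ _ order≡q² Ω _ black-or-white Φ Φ∈Ω = begin
  ℕtoℚ (blackPointsIn Ω Φ)
    ≡⟨ cong ℕtoℚ (length-filter-points (suc m) (λ v → black? Ω v ×-dec incident? Φ v)) ⟩
  ℕtoℚ b
    ≡⟨ blackCount-solution q″ m size b w order≡q² incidences (blacks+whites (black? Ω)) ⟩
  blackCount (suc (suc q″)) (suc m) size
    ∎
  where
  open ≡-Reasoning
  open Arithmetic using (blackDegree; whiteDegree; blackCount-solution)
  open FiniteField F using (order)
  open Projective F
  open HyperplaneFamily Ω
  open PointCounts F using (length-filter-points)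
  open DoubleCounting F Ω Φ∈Ω
  open ProjectiveCounts F (suc (suc q″)) (suc m)
  open DegreeValues F (suc q″) m Ω
  b w : ℕ
  b = blacks (black? Ω)
  w = whites (black? Ω)
  incidences : b ℕ.* blackDegree (suc q″) m ℕ.+ w ℕ.* whiteDegree (suc q″) m ℕ.+ θ order m ≡
               θ order (suc m) ℕ.+ size ℕ.* θ order m
  incidences = ≡.trans
    (cong (ℕ._+ θ order m) (≡.sym (∑-degree-two-valued (black? Ω) _ _ (black-or-white⇒degrees black-or-white))))
    double-count
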